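{- For integers $n, m \geq 0$, let $D_{2,2}(n, m)$ be the number of partitions of $n$ into $m$ parts $\lambda_1 \leq \cdots \leq \lambda_m$ such that $\lambda_{i+1} - \lambda_i \geq 2$ for all $i$, and $\lambda_{i+1} - \lambda_i \geq 3$ unless $\lambda_i$ and $\lambda_{i+1}$ are both odd. Let $D_{2,1}(n, m)$ be the number of such partitions (counted by $D_{2,2}(n,m)$) in which the smallest part is at least $3$. Then \[ \sum_{m, n \geq 0} D_{2,2}(n, m) q^n x^m = \sum_{n_1, n_2 \geq 0} \frac{ q^{4n_2^2 + (3n_1^2 - n_1)/2 + 4n_2 n_1} x^{2n_2 + n_1} }{ (q; q)_{n_1} (q^4; q^4)_{n_2} }, \] \[ \sum_{m, n \geq 0} D_{2,1}(n, m) q^n x^m = \sum_{n_1, n_2 \geq 0} \frac{ q^{4n_2^2 + 4n_2 + (3n_1^2 + 3n_1)/2 + 4n_2 n_1} x^{2n_2 + n_1} }{ (q; q)_{n_1} (q^4; q^4)_{n_2} }. \]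
   Context: A partition of $n$ into $m$ parts is a non-decreasing sequence of $m$ positive integers summing to $n$. For $n \geq 0$, $(a; q)_n = \prod_{j=1}^{n} (1 - a q^{j-1})$, with the empty product equal to $1$. -}

module Defs where

open import Data.Nat using (ℕ; zero; suc; _∸_; _≤ᵇ_; _≡ᵇ_; _/_) renaming (_+_ to _+ℕ_; _*_ to _*ℕ_)
open import Data.Integer using (ℤ; +_; -_; _*_; _+_; _-_)
open import Data.List using (List; []; _∷_; length; map; foldr; filterᵇ; upTo; concatMap; zipWith; applyUpTo)
open import Data.Bool using (Bool; true; false; _∧_; _∨_; if_then_else_)

candidates : ℕ → ℕ → List (List ℕ)
candidates zero    n = [] ∷ []
candidates (suc m) n = concatMap (λ a → map (a ∷_) (candidates m n)) (applyUpTo suc n)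

sumℕ : List ℕ → ℕ
sumℕ = foldr _+ℕ_ 0

allᵇ : (ℕ → Bool) → List ℕ → Bool
allᵇ p []       = true
allᵇ p (a ∷ l)  = p a ∧ allᵇ p l

consecutive : (ℕ → ℕ → Bool) → List ℕ → Bool
consecutive P (a ∷ b ∷ l) = P a b ∧ consecutive P (b ∷ l)
consecutive P _           = true

isPartition : ℕ → List ℕ → Bool
isPartition n l = (sumℕ l ≡ᵇ n) ∧ allᵇ (1 ≤ᵇ_) l ∧ consecutive _≤ᵇ_ l

odd : ℕ → Bool
odd zero          = false
odd (suc zero)    = true
odd (suc (suc n)) = odd n

gapOK : ℕ → ℕ → Bool
gapOK a b = (a +ℕ 2 ≤ᵇ b) ∧ ((a +ℕ 3 ≤ᵇ b) ∨ (odd a ∧ odd b))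

D22 : ℕ → ℕ → ℕ
D22 n m = length (filterᵇ (λ l → isPartition n l ∧ consecutive gapOK l) (candidates m n))

D21 : ℕ → ℕ → ℕ
D21 n m = length (filterᵇ (λ l → isPartition n l ∧ consecutive gapOK l ∧ allᵇ (3 ≤ᵇ_) l)
                          (candidates m n))

Series : Set
Series = ℕ → ℤ

sumℤ : List ℤ → ℤ
sumℤ = foldr _+_ (+ 0)

δ : ℕ → ℕ → ℤ
δ a b = if a ≡ᵇ b then + 1 else + 0

qpow : ℕ → Series
qpow e n = δ n e

oneS : Series
oneS = qpow 0

_⊛_ : Series → Series → Series
(f ⊛ g) n = sumℤ (map (λ k → f k * g (n ∸ k)) (upTo (suc n)))

oneMinusQ : ℕ → Series
oneMinusQ d n = δ n 0 - δ n d

-- (q^a ; q^b)_n = ∏_{j=1}^{n} (1 - q^a (q^b)^{j-1})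
poch : ℕ → ℕ → ℕ → Series
poch a b zero    = oneS
poch a b (suc n) = poch a b n ⊛ oneMinusQ (a +ℕ b *ℕ n)

-- multiplicative inverse of a series with constant term 1:
-- invRev f n = [g_n , g_{n-1} , … , g_0] with g_0 = 1 and
-- g_{n} = - Σ_{k=1}^{n} f_k g_{n-k}
invRev : Series → ℕ → List ℤ
invRev f zero    = + 1 ∷ []
invRev f (suc n) = (- sumℤ (zipWith _*_ (map f (applyUpTo suc (suc n))) L)) ∷ L
  where L = invRev f n

inv : Series → Series
inv f n with invRev f n
... | []    = + 0
... | g ∷ _ = g

-- Bivariate series in q, x : coefficient of q^n x^m given as (n , m)

-- the summand q^e x^k / ((q;q)_{n1} (q^4;q^4)_{n2})
term : (e k n1 n2 : ℕ) → ℕ → ℕ → ℤ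
term e k n1 n2 n m =
  if m ≡ᵇ k then (qpow e ⊛ inv (poch 1 1 n1 ⊛ poch 4 4 n2)) n else + 0

-- coefficient of q^n x^m of Σ_{n1,n2 ≥ 0} T n1 n2, where the x-degree of
-- T n1 n2 is 2 n2 + n1 (so only n1, n2 ≤ m contribute to x^m)
sumTerms : (ℕ → ℕ → ℕ → ℕ → ℤ) → ℕ → ℕ → ℤ
sumTerms T n m = sumℤ (map (λ n1 → sumℤ (map (λ n2 → T n1 n2 n m) (upTo (suc m)))) (upTo (suc m)))

rhs22 : ℕ → ℕ → ℤ
rhs22 = sumTerms (λ n1 n2 →
  term (4 *ℕ n2 *ℕ n2 +ℕ (3 *ℕ n1 *ℕ n1 ∸ n1) / 2 +ℕ 4 *ℕ n2 *ℕ n1) (2 *ℕ n2 +ℕ n1) n1 n2)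

rhs21 : ℕ → ℕ → ℤ
rhs21 = sumTerms (λ n1 n2 →
  term (4 *ℕ n2 *ℕ n2 +ℕ 4 *ℕ n2 +ℕ (3 *ℕ n1 *ℕ n1 +ℕ 3 *ℕ n1) / 2 +ℕ 4 *ℕ n2 *ℕ n1) (2 *ℕ n2 +ℕ n1) n1 n2)

-- Let F_m be the generating function, in q, of the gap partitions counted by D_{2,2}(·, m).
-- Removing the smallest part a leaves a gap partition with parts at least a + 2 (a odd) or
-- a + 3 (a even), and adding 2 to every part preserves all parities, hence all gap
-- conditions. So partitions with smallest part ≥ 3 have generating function q^{2m} F_m,
-- which reduces the D_{2,1} identity to the D_{2,2} one, and sorting by the smallest part
-- (1, 2 or ≥ 3) gives
--   (1 - q^{2m+2}) F_{m+1} = (q^{2m+1} + q^{4m+2}) F_m,    F_0 = 1.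
-- The x^m coefficient of the double sum, the sum of its terms with n₁ + 2 n₂ = m, obeys the
-- same recurrence: term by term the two sides differ by corrections that telescope in n₂,
-- and each term identity is a polynomial identity in q-powers and 1/((q;q)_{n₁} (q⁴;q⁴)_{n₂}).
-- Since 1 - q^{2m+2} is invertible, the recurrence determines F_m.

module Submission where

open import Defs
open import Data.Integer using (+_)
open import Data.Product using (_×_)
open import Relation.Binary.PropositionalEquality using (_≡_)
open import Data.Nat using (ℕ)

module BooleanComparisons where

  open import Data.Nat using (zero; suc; _≤_; _<_; _≤ᵇ_; _≡ᵇ_; _+_; _∸_; s≤s)
  import Data.Nat.Properties as ℕ
  open import Data.Bool using (true; false; if_then_else_; _∧_; T)
  import Data.Bool.Properties as Bool
  open import Data.Empty using (⊥-elim)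
  open import Data.Unit using (tt)
  open import Function using (Equivalence)
  open import Relation.Binary.PropositionalEquality

  ≤ᵇ-true : ∀ {m n} → m ≤ n → (m ≤ᵇ n) ≡ true
  ≤ᵇ-true m≤n = Equivalence.to Bool.T-≡ (ℕ.≤⇒≤ᵇ m≤n)

  ≤ᵇ-false : ∀ {m n} → n < m → (m ≤ᵇ n) ≡ false
  ≤ᵇ-false {m} {n} n<m with m ≤ᵇ n | ℕ.≤ᵇ⇒≤ m n
  ... | false | _   = refl
  ... | true  | m≤n = ⊥-elim (ℕ.<⇒≱ n<m (m≤n tt))

  ≤ᵇ-sound : ∀ {m n} → T (m ≤ᵇ n) → m ≤ n
  ≤ᵇ-sound {m} {n} = ℕ.≤ᵇ⇒≤ m n

  ≤ᵇ-suc : ∀ a n → (suc a ≤ᵇ suc n) ≡ (a ≤ᵇ n)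
  ≤ᵇ-suc zero    n = refl
  ≤ᵇ-suc (suc a) n = refl

  ≡ᵇ-refl : ∀ x → (x ≡ᵇ x) ≡ true
  ≡ᵇ-refl x = Equivalence.to Bool.T-≡ (ℕ.≡⇒≡ᵇ x x refl)

  ≡ᵇ-≢ : ∀ {x y} → x ≢ y → (x ≡ᵇ y) ≡ false
  ≡ᵇ-≢ {x} {y} x≢y with x ≡ᵇ y | ℕ.≡ᵇ⇒≡ x y
  ... | false | _   = refl
  ... | true  | x≡y = ⊥-elim (x≢y (x≡y tt))

  ≡ᵇ-sym : ∀ x y → (x ≡ᵇ y) ≡ (y ≡ᵇ x)
  ≡ᵇ-sym zero    zero    = refl
  ≡ᵇ-sym zero    (suc y) = refl
  ≡ᵇ-sym (suc x) zero    = refl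
  ≡ᵇ-sym (suc x) (suc y) = ≡ᵇ-sym x y

  ≡ᵇ-+ : ∀ c m x → c ≤ m → (m ≡ᵇ c + x) ≡ (x ≡ᵇ m ∸ c)
  ≡ᵇ-+ zero    m       x _         = ≡ᵇ-sym m x
  ≡ᵇ-+ (suc c) (suc m) x (s≤s c≤m) = ≡ᵇ-+ c m x c≤m

  if-cong : ∀ {A : Set} b {x y z : A} → (T b → x ≡ y) → (if b then x else z) ≡ (if b then y else z)
  if-cong true  x≡y = x≡y _
  if-cong false _   = refl

  ∧-absorbˡ : ∀ x y → (T y → T x) → x ∧ y ≡ y
  ∧-absorbˡ x     false _   = Bool.∧-zeroʳ x
  ∧-absorbˡ true  true  _   = refl
  ∧-absorbˡ false true  y⇒x = ⊥-elim (y⇒x tt)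

  ∧-absorbʳ : ∀ x y → (T x → T y) → x ∧ y ≡ x
  ∧-absorbʳ false y     _   = refl
  ∧-absorbʳ true  true  _   = refl
  ∧-absorbʳ true  false x⇒y = ⊥-elim (x⇒y tt)


module GapPartitions where

  open BooleanComparisons
  open import Data.Nat using (zero; suc; _+_; _*_; _∸_; _≤_; _<_; _≤ᵇ_; _≡ᵇ_; z≤n; s≤s)
  import Data.Nat.Properties as ℕ
  open import Data.List using (List; []; _∷_; map; applyUpTo; filterᵇ; length; concatMap; _++_; [_])
  import Data.List.Properties as List
  open import Data.Nat.ListAction.Properties using (sum-++)
  open import Data.Bool using (Bool; true; false; if_then_else_; _∧_; _∨_; T)
  import Data.Bool.Properties as Bool
  open import Data.Product using (_,_; proj₁; proj₂)
  open import Data.Sum using (inj₁; inj₂)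
  open import Data.Empty using (⊥-elim)
  open import Data.Unit using (tt)
  open import Function using (_∘_; Equivalence)
  open import Relation.Nullary using (yes; no)
  open import Relation.Nullary.Decidable using (T?)
  open import Relation.Binary.Definitions using (tri<; tri≈; tri>)
  open import Relation.Binary.PropositionalEquality hiding ([_])
  open import Algebra.Properties.CommutativeSemigroup ℕ.+-commutativeSemigroup
    using () renaming (interchange to +-interchange)

  odd-+2 : ∀ a → odd (a + 2) ≡ odd a
  odd-+2 zero          = refl
  odd-+2 (suc zero)    = refl
  odd-+2 (suc (suc a)) = odd-+2 a

  minNext : ℕ → ℕ
  minNext a = if odd a then a + 2 else a + 3

  minNext-2+ : ∀ a → minNext (2 + a) ≡ 2 + minNext a
  minNext-2+ a with odd a
  ... | true  = refl
  ... | false = refl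

  <-minNext : ∀ a → a < minNext a
  <-minNext a with odd a
  ... | true  = ℕ.m<m+n a (s≤s z≤n)
  ... | false = ℕ.m<m+n a (s≤s z≤n)

  gapOK≡minNext≤ᵇ : ∀ a b → gapOK a b ≡ (minNext a ≤ᵇ b)
  gapOK≡minNext≤ᵇ a b with odd a in odd-a
  ... | false = begin
      (a + 2 ≤ᵇ b) ∧ ((a + 3 ≤ᵇ b) ∨ false)
    ≡⟨ cong ((a + 2 ≤ᵇ b) ∧_) (Bool.∨-identityʳ _) ⟩
      (a + 2 ≤ᵇ b) ∧ (a + 3 ≤ᵇ b)
    ≡⟨ ∧-absorbˡ _ _ (λ a+3≤b → ℕ.≤⇒≤ᵇ (ℕ.≤-trans (ℕ.+-monoʳ-≤ a (ℕ.n≤1+n 2)) (≤ᵇ-sound a+3≤b))) ⟩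
      (a + 3 ≤ᵇ b) ∎
    where open ≡-Reasoning
  ... | true = ∧-absorbʳ _ _ odd-or-far
    where
    odd-or-far : T (a + 2 ≤ᵇ b) → T ((a + 3 ≤ᵇ b) ∨ odd b)
    odd-or-far a+2≤b with ℕ.m≤n⇒m<n∨m≡n (≤ᵇ-sound a+2≤b)
    ... | inj₁ a+2<b  = Equivalence.from Bool.T-∨
                          (inj₁ (ℕ.≤⇒≤ᵇ (ℕ.≤-trans (ℕ.≤-reflexive (ℕ.+-suc a 2)) a+2<b)))
    ... | inj₂ refl   = Equivalence.from Bool.T-∨
                          (inj₂ (Equivalence.from Bool.T-≡ (trans (odd-+2 a) odd-a)))

  isGapChain : ℕ → List ℕ → Bool
  isGapChain lo []      = true
  isGapChain lo (a ∷ l) = (lo ≤ᵇ a) ∧ isGapChain (minNext a) l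

  gapOK⇒≤ : ∀ a b → T (gapOK a b) → a ≤ b
  gapOK⇒≤ a b gap = ℕ.≤-trans (ℕ.<⇒≤ (<-minNext a))
                              (≤ᵇ-sound (subst T (gapOK≡minNext≤ᵇ a b) gap))

  gaps⇒sorted : ∀ l → T (consecutive gapOK l) → T (consecutive _≤ᵇ_ l)
  gaps⇒sorted []          _    = tt
  gaps⇒sorted (a ∷ [])    _    = tt
  gaps⇒sorted (a ∷ b ∷ l) gaps = Equivalence.from Bool.T-∧
    (ℕ.≤⇒≤ᵇ (gapOK⇒≤ a b (proj₁ split)) , gaps⇒sorted (b ∷ l) (proj₂ split))
    where
    split : T (gapOK a b) × T (consecutive gapOK (b ∷ l))
    split = Equivalence.to Bool.T-∧ gaps

  gaps⇒bounded : ∀ lo a l → lo ≤ a → T (consecutive gapOK (a ∷ l)) → T (allᵇ (lo ≤ᵇ_) (a ∷ l))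
  gaps⇒bounded lo a []      lo≤a _    = Equivalence.from Bool.T-∧ (ℕ.≤⇒≤ᵇ lo≤a , tt)
  gaps⇒bounded lo a (b ∷ l) lo≤a gaps = Equivalence.from Bool.T-∧
    (ℕ.≤⇒≤ᵇ lo≤a , gaps⇒bounded lo b l (ℕ.≤-trans lo≤a (gapOK⇒≤ a b (proj₁ split))) (proj₂ split))
    where
    split : T (gapOK a b) × T (consecutive gapOK (b ∷ l))
    split = Equivalence.to Bool.T-∧ gaps

  isGapChain-consecutive : ∀ lo a l → (lo ≤ᵇ a) ∧ consecutive gapOK (a ∷ l) ≡ isGapChain lo (a ∷ l)
  isGapChain-consecutive lo a []      = refl
  isGapChain-consecutive lo a (b ∷ l) = cong ((lo ≤ᵇ a) ∧_) (begin
      gapOK a b ∧ consecutive gapOK (b ∷ l)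
    ≡⟨ cong (_∧ consecutive gapOK (b ∷ l)) (gapOK≡minNext≤ᵇ a b) ⟩
      (minNext a ≤ᵇ b) ∧ consecutive gapOK (b ∷ l)
    ≡⟨ isGapChain-consecutive (minNext a) b l ⟩
      isGapChain (minNext a) (b ∷ l) ∎)
    where open ≡-Reasoning

  isGapChain-characterization : ∀ lo l →
    allᵇ (lo ≤ᵇ_) l ∧ (consecutive _≤ᵇ_ l ∧ consecutive gapOK l) ≡ isGapChain lo l
  isGapChain-characterization lo []      = refl
  isGapChain-characterization lo (a ∷ l) = begin
      ((lo ≤ᵇ a) ∧ allᵇ (lo ≤ᵇ_) l) ∧ (consecutive _≤ᵇ_ (a ∷ l) ∧ gaps)
    ≡⟨ cong (((lo ≤ᵇ a) ∧ allᵇ (lo ≤ᵇ_) l) ∧_) (∧-absorbˡ _ gaps (gaps⇒sorted (a ∷ l))) ⟩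
      ((lo ≤ᵇ a) ∧ allᵇ (lo ≤ᵇ_) l) ∧ gaps
    ≡⟨ Bool.∧-assoc (lo ≤ᵇ a) _ gaps ⟩
      (lo ≤ᵇ a) ∧ (allᵇ (lo ≤ᵇ_) l ∧ gaps)
    ≡⟨ bounds-absorbed (lo ≤ᵇ a) refl ⟩
      (lo ≤ᵇ a) ∧ gaps
    ≡⟨ isGapChain-consecutive lo a l ⟩
      isGapChain lo (a ∷ l) ∎
    where
    open ≡-Reasoning
    gaps : Bool
    gaps = consecutive gapOK (a ∷ l)
    bounds-absorbed : ∀ b → (lo ≤ᵇ a) ≡ b → b ∧ (allᵇ (lo ≤ᵇ_) l ∧ gaps) ≡ b ∧ gaps
    bounds-absorbed false _    = refl
    bounds-absorbed true  lo≤a = ∧-absorbˡ _ gaps (λ g → proj₂ (Equivalence.to Bool.T-∧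
                         (gaps⇒bounded lo a l (≤ᵇ-sound (subst T (sym lo≤a) tt)) g)))

  isGapPartition : ℕ → ℕ → List ℕ → Bool
  isGapPartition lo n l = (sumℕ l ≡ᵇ n) ∧ isGapChain lo l

  D22-predicate : ∀ n l → isPartition n l ∧ consecutive gapOK l ≡ isGapPartition 1 n l
  D22-predicate n l = begin
      ((sumℕ l ≡ᵇ n) ∧ (allᵇ (1 ≤ᵇ_) l ∧ consecutive _≤ᵇ_ l)) ∧ consecutive gapOK l
    ≡⟨ Bool.∧-assoc (sumℕ l ≡ᵇ n) _ _ ⟩
      (sumℕ l ≡ᵇ n) ∧ ((allᵇ (1 ≤ᵇ_) l ∧ consecutive _≤ᵇ_ l) ∧ consecutive gapOK l)
    ≡⟨ cong ((sumℕ l ≡ᵇ n) ∧_) (Bool.∧-assoc (allᵇ (1 ≤ᵇ_) l) _ _) ⟩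
      (sumℕ l ≡ᵇ n) ∧ (allᵇ (1 ≤ᵇ_) l ∧ (consecutive _≤ᵇ_ l ∧ consecutive gapOK l))
    ≡⟨ cong ((sumℕ l ≡ᵇ n) ∧_) (isGapChain-characterization 1 l) ⟩
      isGapPartition 1 n l ∎
    where open ≡-Reasoning

  all-3≤⇒all-1≤ : ∀ l → T (allᵇ (3 ≤ᵇ_) l) → T (allᵇ (1 ≤ᵇ_) l)
  all-3≤⇒all-1≤ []                        _   = tt
  all-3≤⇒all-1≤ (suc (suc (suc a)) ∷ l) all = all-3≤⇒all-1≤ l all

  D21-predicate : ∀ n l →
    isPartition n l ∧ consecutive gapOK l ∧ allᵇ (3 ≤ᵇ_) l ≡ isGapPartition 3 n l
  D21-predicate n l =
    trans (regroup (sumℕ l ≡ᵇ n) (allᵇ (1 ≤ᵇ_) l) (consecutive _≤ᵇ_ l) (consecutive gapOK l)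
                   (allᵇ (3 ≤ᵇ_) l) (all-3≤⇒all-1≤ l))
          (cong ((sumℕ l ≡ᵇ n) ∧_) (isGapChain-characterization 3 l))
    where
    regroup : ∀ s a c g b → (T b → T a) → (s ∧ (a ∧ c)) ∧ (g ∧ b) ≡ s ∧ (b ∧ (c ∧ g))
    regroup false a     c g b     _   = refl
    regroup true  a     c g false _   = trans (cong ((a ∧ c) ∧_) (Bool.∧-zeroʳ g)) (Bool.∧-zeroʳ (a ∧ c))
    regroup true  false c g true  b⇒a = ⊥-elim (b⇒a tt)
    regroup true  true  c g true  _   = cong (c ∧_) (Bool.∧-identityʳ g)

  ∑₁ : ℕ → (ℕ → ℕ) → ℕ
  ∑₁ zero    g = 0
  ∑₁ (suc N) g = ∑₁ N g + g (suc N)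

  sumℕ-map-applyUpTo-suc : ∀ N g → sumℕ (map g (applyUpTo suc N)) ≡ ∑₁ N g
  sumℕ-map-applyUpTo-suc zero    g = refl
  sumℕ-map-applyUpTo-suc (suc N) g = begin
      sumℕ (map g (applyUpTo suc (suc N)))
    ≡⟨ cong (sumℕ ∘ map g) (List.applyUpTo-∷ʳ suc N) ⟨
      sumℕ (map g (applyUpTo suc N ++ [ suc N ]))
    ≡⟨ cong sumℕ (List.map-++ g (applyUpTo suc N) [ suc N ]) ⟩
      sumℕ (map g (applyUpTo suc N) ++ [ g (suc N) ])
    ≡⟨ sum-++ (map g (applyUpTo suc N)) [ g (suc N) ] ⟩
      sumℕ (map g (applyUpTo suc N)) + (g (suc N) + 0)
    ≡⟨ cong₂ _+_ (sumℕ-map-applyUpTo-suc N g) (ℕ.+-identityʳ (g (suc N))) ⟩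
      ∑₁ N g + g (suc N) ∎
    where open ≡-Reasoning

  ∑₁-cong : ∀ N {g g′ : ℕ → ℕ} → (∀ a → a ≤ N → g a ≡ g′ a) → ∑₁ N g ≡ ∑₁ N g′
  ∑₁-cong zero    eq = refl
  ∑₁-cong (suc N) eq = cong₂ _+_ (∑₁-cong N (λ a a≤N → eq a (ℕ.m≤n⇒m≤1+n a≤N))) (eq (suc N) ℕ.≤-refl)

  ∑₁-zero : ∀ N (g : ℕ → ℕ) → (∀ a → a ≤ N → g a ≡ 0) → ∑₁ N g ≡ 0
  ∑₁-zero N g g≡0 = trans (∑₁-cong N g≡0) (∑₁-zero′ N)
    where
    ∑₁-zero′ : ∀ N → ∑₁ N (λ _ → 0) ≡ 0
    ∑₁-zero′ zero    = refl
    ∑₁-zero′ (suc N) = cong (_+ 0) (∑₁-zero′ N)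

  ∑₁-extend : ∀ n d (g : ℕ → ℕ) → (∀ a → n < a → g a ≡ 0) → ∑₁ (n + d) g ≡ ∑₁ n g
  ∑₁-extend n zero    g g≡0 = cong (λ x → ∑₁ x g) (ℕ.+-identityʳ n)
  ∑₁-extend n (suc d) g g≡0 = begin
      ∑₁ (n + suc d) g
    ≡⟨ cong (λ x → ∑₁ x g) (ℕ.+-suc n d) ⟩
      ∑₁ (n + d) g + g (suc (n + d))
    ≡⟨ cong₂ _+_ (∑₁-extend n d g g≡0) (g≡0 (suc (n + d)) (s≤s (ℕ.m≤m+n n d))) ⟩
      ∑₁ n g + 0
    ≡⟨ ℕ.+-identityʳ _ ⟩
      ∑₁ n g ∎
    where open ≡-Reasoning

  ∑₁-distrib-+ : ∀ N (g h : ℕ → ℕ) → ∑₁ N (λ a → g a + h a) ≡ ∑₁ N g + ∑₁ N h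
  ∑₁-distrib-+ zero    g h = refl
  ∑₁-distrib-+ (suc N) g h = trans (cong (_+ (g (suc N) + h (suc N))) (∑₁-distrib-+ N g h))
                                   (+-interchange (∑₁ N g) (∑₁ N h) (g (suc N)) (h (suc N)))

  filterᵇ-cong : ∀ {A : Set} {P Q : A → Bool} → (∀ x → P x ≡ Q x) → ∀ xs → filterᵇ P xs ≡ filterᵇ Q xs
  filterᵇ-cong {P = P} {Q} P≡Q []       = refl
  filterᵇ-cong {P = P} {Q} P≡Q (x ∷ xs) with P x | Q x | P≡Q x
  ... | true  | true  | _ = cong (x ∷_) (filterᵇ-cong P≡Q xs)
  ... | false | false | _ = filterᵇ-cong P≡Q xs

  length-filterᵇ-map : ∀ {A B : Set} (P : B → Bool) (f : A → B) xs →
    length (filterᵇ P (map f xs)) ≡ length (filterᵇ (P ∘ f) xs)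
  length-filterᵇ-map P f []       = refl
  length-filterᵇ-map P f (x ∷ xs) with P (f x)
  ... | true  = cong suc (length-filterᵇ-map P f xs)
  ... | false = length-filterᵇ-map P f xs

  length-filterᵇ-prefixes : ∀ (P : List ℕ → Bool) (C : List (List ℕ)) xs →
    length (filterᵇ P (concatMap (λ a → map (a ∷_) C) xs))
      ≡ sumℕ (map (λ a → length (filterᵇ (P ∘ (a ∷_)) C)) xs)
  length-filterᵇ-prefixes P C []       = refl
  length-filterᵇ-prefixes P C (x ∷ xs) = begin
      length (filterᵇ P (map (x ∷_) C ++ rest))
    ≡⟨ cong length (List.filter-++ (T? ∘ P) (map (x ∷_) C) rest) ⟩
      length (filterᵇ P (map (x ∷_) C) ++ filterᵇ P rest)
    ≡⟨ List.length-++ (filterᵇ P (map (x ∷_) C)) ⟩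
      length (filterᵇ P (map (x ∷_) C)) + length (filterᵇ P rest)
    ≡⟨ cong₂ _+_ (length-filterᵇ-map P (x ∷_) C) (length-filterᵇ-prefixes P C xs) ⟩
      length (filterᵇ (P ∘ (x ∷_)) C) + sumℕ (map (λ a → length (filterᵇ (P ∘ (a ∷_)) C)) xs) ∎
    where
    open ≡-Reasoning
    rest : List (List ℕ)
    rest = concatMap (λ a → map (a ∷_) C) xs

  length-filterᵇ-guarded : ∀ c (Q : List ℕ → Bool) C →
    length (filterᵇ (λ l → c ∧ Q l) C) ≡ (if c then length (filterᵇ Q C) else 0)
  length-filterᵇ-guarded true  Q C = refl
  length-filterᵇ-guarded false Q C = cong length (none C)
    where
    none : ∀ (C : List (List ℕ)) → filterᵇ (λ _ → false) C ≡ []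
    none []      = refl
    none (_ ∷ C) = none C

  +≡ᵇ : ∀ a s n → (a + s ≡ᵇ n) ≡ (a ≤ᵇ n) ∧ (s ≡ᵇ n ∸ a)
  +≡ᵇ zero    s n       = refl
  +≡ᵇ (suc a) s zero    = refl
  +≡ᵇ (suc a) s (suc n) = trans (+≡ᵇ a s n) (cong (_∧ (s ≡ᵇ n ∸ a)) (sym (≤ᵇ-suc a n)))

  isGapPartition-∷ : ∀ lo n a l →
    isGapPartition lo n (a ∷ l) ≡ ((lo ≤ᵇ a) ∧ (a ≤ᵇ n)) ∧ isGapPartition (minNext a) (n ∸ a) l
  isGapPartition-∷ lo n a l = trans (cong (_∧ isGapChain lo (a ∷ l)) (+≡ᵇ a (sumℕ l) n))
                                    (regroup (a ≤ᵇ n) (sumℕ l ≡ᵇ n ∸ a) (lo ≤ᵇ a) _)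
    where
    regroup : ∀ x s y w → (x ∧ s) ∧ (y ∧ w) ≡ (y ∧ x) ∧ (s ∧ w)
    regroup false s false w = refl
    regroup false s true  w = refl
    regroup true  s false w = Bool.∧-zeroʳ s
    regroup true  s true  w = refl

  gapCount : ℕ → ℕ → ℕ → ℕ
  gapCount lo n zero    = if n ≡ᵇ 0 then 1 else 0
  gapCount lo n (suc m) = ∑₁ n (λ a → if lo ≤ᵇ a then gapCount (minNext a) (n ∸ a) m else 0)

  count-candidates : ∀ m lo n N → n ≤ N →
    length (filterᵇ (isGapPartition lo n) (candidates m N)) ≡ gapCount lo n m
  count-candidates zero    lo zero    N _   = refl
  count-candidates zero    lo (suc n) N _   = refl
  count-candidates (suc m) lo n       N n≤N = begin
      length (filterᵇ (isGapPartition lo n) (concatMap (λ a → map (a ∷_) (candidates m N)) (applyUpTo suc N)))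
    ≡⟨ length-filterᵇ-prefixes (isGapPartition lo n) (candidates m N) (applyUpTo suc N) ⟩
      sumℕ (map (λ a → length (filterᵇ (isGapPartition lo n ∘ (a ∷_)) (candidates m N))) (applyUpTo suc N))
    ≡⟨ sumℕ-map-applyUpTo-suc N _ ⟩
      ∑₁ N (λ a → length (filterᵇ (isGapPartition lo n ∘ (a ∷_)) (candidates m N)))
    ≡⟨ ∑₁-cong N (λ a _ → first-part a) ⟩
      ∑₁ N (λ a → if (lo ≤ᵇ a) ∧ (a ≤ᵇ n) then gapCount (minNext a) (n ∸ a) m else 0)
    ≡⟨ cong (λ x → ∑₁ x guarded) (ℕ.m+[n∸m]≡n n≤N) ⟨
      ∑₁ (n + (N ∸ n)) guarded
    ≡⟨ ∑₁-extend n (N ∸ n) guarded (λ a n<a → cong (λ b → if b then _ else 0)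
                                             (trans (cong ((lo ≤ᵇ a) ∧_) (≤ᵇ-false n<a)) (Bool.∧-zeroʳ _))) ⟩
      ∑₁ n guarded
    ≡⟨ ∑₁-cong n (λ a a≤n → cong (λ b → if b then _ else 0)
                                 (trans (cong ((lo ≤ᵇ a) ∧_) (≤ᵇ-true a≤n)) (Bool.∧-identityʳ _))) ⟩
      gapCount lo n (suc m) ∎
    where
    open ≡-Reasoning
    guarded : ℕ → ℕ
    guarded a = if (lo ≤ᵇ a) ∧ (a ≤ᵇ n) then gapCount (minNext a) (n ∸ a) m else 0
    first-part : ∀ a → length (filterᵇ (isGapPartition lo n ∘ (a ∷_)) (candidates m N)) ≡ guarded a
    first-part a = begin
        length (filterᵇ (isGapPartition lo n ∘ (a ∷_)) (candidates m N))
      ≡⟨ cong length (filterᵇ-cong (isGapPartition-∷ lo n a) (candidates m N)) ⟩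
        length (filterᵇ (λ l → ((lo ≤ᵇ a) ∧ (a ≤ᵇ n)) ∧ isGapPartition (minNext a) (n ∸ a) l) (candidates m N))
      ≡⟨ length-filterᵇ-guarded _ (isGapPartition (minNext a) (n ∸ a)) (candidates m N) ⟩
        (if (lo ≤ᵇ a) ∧ (a ≤ᵇ n) then length (filterᵇ (isGapPartition (minNext a) (n ∸ a)) (candidates m N)) else 0)
      ≡⟨ cong (λ x → if (lo ≤ᵇ a) ∧ (a ≤ᵇ n) then x else 0)
              (count-candidates m (minNext a) (n ∸ a) N (ℕ.≤-trans (ℕ.m∸n≤m n a) n≤N)) ⟩
        guarded a ∎

  D22≡gapCount : ∀ n m → D22 n m ≡ gapCount 1 n m
  D22≡gapCount n m = trans (cong length (filterᵇ-cong (D22-predicate n) (candidates m n)))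
                           (count-candidates m 1 n n ℕ.≤-refl)

  D21≡gapCount : ∀ n m → D21 n m ≡ gapCount 3 n m
  D21≡gapCount n m = trans (cong length (filterᵇ-cong (D21-predicate n) (candidates m n)))
                           (count-candidates m 3 n n ℕ.≤-refl)

  if-≤ᵇ-split : ∀ lo a x →
    (if lo ≤ᵇ a then x else 0) ≡ (if lo ≡ᵇ a then x else 0) + (if suc lo ≤ᵇ a then x else 0)
  if-≤ᵇ-split zero     zero    x = sym (ℕ.+-identityʳ x)
  if-≤ᵇ-split zero     (suc a) x = refl
  if-≤ᵇ-split (suc lo) zero    x = refl
  if-≤ᵇ-split (suc lo) (suc a) x = trans (cong (λ b → if b then x else 0) (≤ᵇ-suc lo a))
                                         (if-≤ᵇ-split lo a x)

  ∑₁-pick : ∀ N lo (X : ℕ → ℕ) → 1 ≤ lo →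
    ∑₁ N (λ a → if lo ≡ᵇ a then X a else 0) ≡ (if lo ≤ᵇ N then X lo else 0)
  ∑₁-pick zero    (suc lo) X _ = refl
  ∑₁-pick (suc N) lo       X 1≤lo with ℕ.<-cmp lo (suc N)
  ... | tri< lo<1+N _ _
    rewrite ∑₁-pick N lo X 1≤lo | ≡ᵇ-≢ (ℕ.<⇒≢ lo<1+N)
          | ≤ᵇ-true (ℕ.≤-pred lo<1+N) | ≤ᵇ-true (ℕ.<⇒≤ lo<1+N) = ℕ.+-identityʳ (X lo)
  ... | tri≈ _ refl _
    rewrite ∑₁-pick N lo X 1≤lo | ≡ᵇ-refl lo | ≤ᵇ-false {lo} {N} ℕ.≤-refl | ≤ᵇ-true (ℕ.≤-refl {lo}) = refl
  ... | tri> _ _ 1+N<lo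
    rewrite ∑₁-pick N lo X 1≤lo | ≡ᵇ-≢ (ℕ.>⇒≢ 1+N<lo)
          | ≤ᵇ-false (ℕ.<-trans (ℕ.n<1+n N) 1+N<lo) | ≤ᵇ-false 1+N<lo = refl

  gapCount-peel : ∀ lo n m → 1 ≤ lo →
    gapCount lo n (suc m) ≡ (if lo ≤ᵇ n then gapCount (minNext lo) (n ∸ lo) m else 0) + gapCount (suc lo) n (suc m)
  gapCount-peel lo n m 1≤lo = begin
      gapCount lo n (suc m)
    ≡⟨ ∑₁-cong n (λ a _ → if-≤ᵇ-split lo a (X a)) ⟩
      ∑₁ n (λ a → (if lo ≡ᵇ a then X a else 0) + (if suc lo ≤ᵇ a then X a else 0))
    ≡⟨ ∑₁-distrib-+ n _ _ ⟩
      ∑₁ n (λ a → if lo ≡ᵇ a then X a else 0) + gapCount (suc lo) n (suc m)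
    ≡⟨ cong (_+ gapCount (suc lo) n (suc m)) (∑₁-pick n lo X 1≤lo) ⟩
      (if lo ≤ᵇ n then X lo else 0) + gapCount (suc lo) n (suc m) ∎
    where
    open ≡-Reasoning
    X : ℕ → ℕ
    X a = gapCount (minNext a) (n ∸ a) m

  gapCount-below : ∀ lo n m → n < lo → gapCount lo n (suc m) ≡ 0
  gapCount-below lo n m n<lo = ∑₁-zero n _ (λ a a≤n →
    cong (λ b → if b then gapCount (minNext a) (n ∸ a) m else 0) (≤ᵇ-false (ℕ.≤-<-trans a≤n n<lo)))

  gapCount-small : ∀ m lo n → n < lo * m → gapCount lo n m ≡ 0
  gapCount-small zero    lo n n<0 = ⊥-elim (ℕ.n≮0 (subst (n <_) (ℕ.*-zeroʳ lo) n<0))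
  gapCount-small (suc m) lo n n<lo*m = ∑₁-zero n _ first-part
    where
    first-part : ∀ a → a ≤ n → (if lo ≤ᵇ a then gapCount (minNext a) (n ∸ a) m else 0) ≡ 0
    first-part a a≤n with lo ≤ᵇ a in lo≤ᵇa
    ... | false = refl
    ... | true  = gapCount-small m (minNext a) (n ∸ a) (ℕ.<-≤-trans remainder (ℕ.*-monoˡ-≤ m lo≤minNext))
      where
      lo≤a : lo ≤ a
      lo≤a = ≤ᵇ-sound (subst T (sym lo≤ᵇa) tt)
      lo≤minNext : lo ≤ minNext a
      lo≤minNext = ℕ.≤-trans lo≤a (ℕ.<⇒≤ (<-minNext a))
      remainder : n ∸ a < lo * m
      remainder = ℕ.+-cancelˡ-< a (n ∸ a) (lo * m) (begin-strict
          a + (n ∸ a)   ≡⟨ ℕ.m+[n∸m]≡n a≤n ⟩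
          n             <⟨ n<lo*m ⟩
          lo * suc m    ≡⟨ ℕ.*-suc lo m ⟩
          lo + lo * m   ≤⟨ ℕ.+-monoˡ-≤ (lo * m) lo≤a ⟩
          a + lo * m    ∎)
        where open ℕ.≤-Reasoning

  gapCount-shift : ∀ m lo n → 1 ≤ lo → gapCount (2 + lo) (2 * m + n) m ≡ gapCount lo n m
  gapCount-shift zero    lo n _    = refl
  gapCount-shift (suc m) lo n 1≤lo = peel (suc n) lo 1≤lo (ℕ.<-≤-trans (ℕ.n<1+n n) (ℕ.m≤n+m (suc n) lo))
    where
    N : ℕ
    N = 2 * suc m + n

    2*suc : 2 * suc m + n ≡ 2 + (2 * m + n)
    2*suc = cong (_+ n) (ℕ.*-suc 2 m)

    both-empty : ∀ lo → n < lo → gapCount (2 + lo) N (suc m) ≡ gapCount lo n (suc m)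
    both-empty lo n<lo = trans (gapCount-small (suc m) (2 + lo) N (begin-strict
        2 * suc m + n        <⟨ ℕ.+-monoʳ-< (2 * suc m) (ℕ.<-≤-trans n<lo (ℕ.m≤m*n lo (suc m))) ⟩
        2 * suc m + lo * suc m ≡⟨ ℕ.*-distribʳ-+ (suc m) 2 lo ⟨
        (2 + lo) * suc m     ∎))
      (sym (gapCount-below lo n m n<lo))
      where open ℕ.≤-Reasoning

    peel : ∀ f lo → 1 ≤ lo → n < lo + f → gapCount (2 + lo) N (suc m) ≡ gapCount lo n (suc m)
    peel zero    lo _    n<lo+0 = both-empty lo (subst (n <_) (ℕ.+-identityʳ lo) n<lo+0)
    peel (suc f) lo 1≤lo n<lo+f with lo ℕ.≤? n
    ... | no  lo≰n = both-empty lo (ℕ.≰⇒> lo≰n)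
    ... | yes lo≤n = begin
        gapCount (2 + lo) N (suc m)
      ≡⟨ gapCount-peel (2 + lo) N m (s≤s z≤n) ⟩
        (if 2 + lo ≤ᵇ N then gapCount (minNext (2 + lo)) (N ∸ (2 + lo)) m else 0) + gapCount (3 + lo) N (suc m)
      ≡⟨ cong₂ _+_ first-part (peel f (suc lo) (s≤s z≤n) (subst (n <_) (ℕ.+-suc lo f) n<lo+f)) ⟩
        (if lo ≤ᵇ n then gapCount (minNext lo) (n ∸ lo) m else 0) + gapCount (suc lo) n (suc m)
      ≡⟨ gapCount-peel lo n m 1≤lo ⟨
        gapCount lo n (suc m) ∎
      where
      open ≡-Reasoning
      2+lo≤N : (2 + lo ≤ᵇ N) ≡ true
      2+lo≤N = ≤ᵇ-true (subst (2 + lo ≤_) (sym 2*suc) (s≤s (s≤s (ℕ.≤-trans lo≤n (ℕ.m≤n+m n (2 * m))))))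
      N∸[2+lo] : N ∸ (2 + lo) ≡ 2 * m + (n ∸ lo)
      N∸[2+lo] = trans (cong (_∸ (2 + lo)) 2*suc) (ℕ.+-∸-assoc (2 * m) lo≤n)
      first-part : (if 2 + lo ≤ᵇ N then gapCount (minNext (2 + lo)) (N ∸ (2 + lo)) m else 0)
                 ≡ (if lo ≤ᵇ n then gapCount (minNext lo) (n ∸ lo) m else 0)
      first-part rewrite 2+lo≤N | ≤ᵇ-true lo≤n | minNext-2+ lo | N∸[2+lo] =
        gapCount-shift m (minNext lo) (n ∸ lo) (ℕ.≤-trans (s≤s z≤n) (<-minNext lo))

  delay : ℕ → (ℕ → ℕ) → ℕ → ℕ
  delay a g y = if a ≤ᵇ y then g (y ∸ a) else 0

  delay-cong : ∀ a {g g′ : ℕ → ℕ} → (∀ z → g z ≡ g′ z) → ∀ y → delay a g y ≡ delay a g′ y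
  delay-cong a g≡g′ y with a ≤ᵇ y
  ... | true  = g≡g′ (y ∸ a)
  ... | false = refl

  delay-delay : ∀ a b g y → delay a (delay b g) y ≡ delay (a + b) g y
  delay-delay a b g y with a ℕ.≤? y
  ... | no a≰y rewrite ≤ᵇ-false (ℕ.≰⇒> a≰y) | ≤ᵇ-false (ℕ.<-≤-trans (ℕ.≰⇒> a≰y) (ℕ.m≤m+n a b)) = refl
  ... | yes a≤y rewrite ≤ᵇ-true a≤y with b ℕ.≤? y ∸ a
  ...   | yes b≤y∸a rewrite ≤ᵇ-true b≤y∸a | ≤ᵇ-true (subst (_≤ y) (ℕ.+-comm b a) (ℕ.m≤o∸n⇒m+n≤o b a≤y b≤y∸a))
          = cong g (ℕ.∸-+-assoc y a b)
  ...   | no b≰y∸a rewrite ≤ᵇ-false (ℕ.≰⇒> b≰y∸a)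
                         | ≤ᵇ-false (ℕ.≰⇒> (b≰y∸a ∘ ℕ.m+n≤o⇒m≤o∸n b ∘ subst (_≤ y) (ℕ.+-comm a b))) = refl

  gapCount-shift-delay : ∀ m lo y → 1 ≤ lo → gapCount (2 + lo) y m ≡ delay (2 * m) (λ z → gapCount lo z m) y
  gapCount-shift-delay m lo y 1≤lo with 2 * m ≤ᵇ y in 2m≤ᵇy
  ... | true  = trans (cong (λ z → gapCount (2 + lo) z m) (sym (ℕ.m+[n∸m]≡n 2m≤y)))
                      (gapCount-shift m lo (y ∸ 2 * m) 1≤lo)
    where
    2m≤y : 2 * m ≤ y
    2m≤y = ≤ᵇ-sound (subst T (sym 2m≤ᵇy) tt)
  ... | false = gapCount-small m (2 + lo) y (ℕ.<-≤-trans y<2m (begin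
      2 * m            ≤⟨ ℕ.m≤m+n (2 * m) (lo * m) ⟩
      2 * m + lo * m   ≡⟨ ℕ.*-distribʳ-+ m 2 lo ⟨
      (2 + lo) * m     ∎))
    where
    open ℕ.≤-Reasoning
    y<2m : y < 2 * m
    y<2m = ℕ.≰⇒> (λ 2m≤y → subst T 2m≤ᵇy (ℕ.≤⇒≤ᵇ 2m≤y))

  gapCount-recurrence : ∀ n m → gapCount 1 n (suc m) ≡
    delay (1 + 2 * m) (λ z → gapCount 1 z m) n
      + (delay (2 + (2 * m + 2 * m)) (λ z → gapCount 1 z m) n + delay (2 * suc m) (λ z → gapCount 1 z (suc m)) n)
  gapCount-recurrence n m = begin
      gapCount 1 n (suc m)
    ≡⟨ gapCount-peel 1 n m (s≤s z≤n) ⟩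
      delay 1 (λ z → gapCount 3 z m) n + gapCount 2 n (suc m)
    ≡⟨ cong₂ _+_ first-part≡1 (gapCount-peel 2 n m (s≤s z≤n)) ⟩
      delay (1 + 2 * m) g n + (delay 2 (λ z → gapCount 5 z m) n + gapCount 3 n (suc m))
    ≡⟨ cong (_+_ (delay (1 + 2 * m) g n)) (cong₂ _+_ first-part≡2 (gapCount-shift-delay (suc m) 1 n (s≤s z≤n))) ⟩
      delay (1 + 2 * m) g n + (delay (2 + (2 * m + 2 * m)) g n + delay (2 * suc m) (λ z → gapCount 1 z (suc m)) n) ∎
    where
    open ≡-Reasoning
    g : ℕ → ℕ
    g z = gapCount 1 z m
    first-part≡1 : delay 1 (λ z → gapCount 3 z m) n ≡ delay (1 + 2 * m) g n
    first-part≡1 = trans (delay-cong 1 (λ z → gapCount-shift-delay m 1 z (s≤s z≤n)) n) (delay-delay 1 (2 * m) g n)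
    first-part≡2 : delay 2 (λ z → gapCount 5 z m) n ≡ delay (2 + (2 * m + 2 * m)) g n
    first-part≡2 = begin
        delay 2 (λ z → gapCount 5 z m) n
      ≡⟨ delay-cong 2 (λ z → gapCount-shift-delay m 3 z (s≤s z≤n)) n ⟩
        delay 2 (delay (2 * m) (λ z → gapCount 3 z m)) n
      ≡⟨ delay-cong 2 (delay-cong (2 * m) (λ z → gapCount-shift-delay m 1 z (s≤s z≤n))) n ⟩
        delay 2 (delay (2 * m) (delay (2 * m) g)) n
      ≡⟨ delay-cong 2 (delay-delay (2 * m) (2 * m) g) n ⟩
        delay 2 (delay (2 * m + 2 * m) g) n
      ≡⟨ delay-delay 2 (2 * m + 2 * m) g n ⟩
        delay (2 + (2 * m + 2 * m)) g n ∎


module PowerSeries where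

  open import Data.Nat using (zero; suc; _∸_; _≡ᵇ_; z≤n; s≤s)
    renaming (_+_ to _+ℕ_; _≤_ to _≤ℕ_; _<_ to _<ℕ_)
  import Data.Nat.Properties as ℕ
  open import Data.Integer using (ℤ; -_; _*_; _+_; _-_)
  import Data.Integer.Properties as ℤ
  open import Data.List using (_∷_; map; applyUpTo; upTo; zipWith)
  open import Data.List.Properties using (map-applyUpTo)
  open import Data.Bool using (if_then_else_)
  open import Data.Maybe using (Maybe; just; nothing)
  open import Data.Product using (_,_)
  open import Function using (_∘_; id)
  open import Relation.Nullary using (yes; no)
  open import Relation.Binary.PropositionalEquality
  open import Algebra.Bundles using (CommutativeRing)
  import Relation.Binary.Reasoning.Setoid as SetoidReasoning
  import Algebra.Solver.Ring
  open import Algebra.Solver.Ring.AlmostCommutativeRing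
    using (fromCommutativeRing; _-Raw-AlmostCommutative⟶_)
  open import Data.Integer.Tactic.RingSolver using () renaming (solve-∀ to ℤ-solve-∀)
  open import Algebra.Properties.CommutativeSemigroup ℤ.+-commutativeSemigroup
    using () renaming (interchange to +-interchange)

  ∑ : ℕ → (ℕ → ℤ) → ℤ
  ∑ zero    h = h 0
  ∑ (suc n) h = h 0 + ∑ n (h ∘ suc)

  sumℤ-applyUpTo : ∀ n (h : ℕ → ℤ) → sumℤ (applyUpTo h (suc n)) ≡ ∑ n h
  sumℤ-applyUpTo zero    h = ℤ.+-identityʳ (h 0)
  sumℤ-applyUpTo (suc n) h = cong (_+_ (h 0)) (sumℤ-applyUpTo n (h ∘ suc))

  sumℤ-map-upTo : ∀ n (h : ℕ → ℤ) → sumℤ (map h (upTo (suc n))) ≡ ∑ n h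
  sumℤ-map-upTo n h = trans (cong sumℤ (map-applyUpTo id h (suc n))) (sumℤ-applyUpTo n h)

  ∑-cong-≤ : ∀ n {h h′ : ℕ → ℤ} → (∀ k → k ≤ℕ n → h k ≡ h′ k) → ∑ n h ≡ ∑ n h′
  ∑-cong-≤ zero    eq = eq 0 z≤n
  ∑-cong-≤ (suc n) eq = cong₂ _+_ (eq 0 z≤n) (∑-cong-≤ n (λ k k≤n → eq (suc k) (s≤s k≤n)))

  ∑-cong : ∀ n {h h′ : ℕ → ℤ} → (∀ k → h k ≡ h′ k) → ∑ n h ≡ ∑ n h′
  ∑-cong n eq = ∑-cong-≤ n (λ k _ → eq k)

  ∑-zero : ∀ n → ∑ n (λ _ → + 0) ≡ + 0
  ∑-zero zero    = refl
  ∑-zero (suc n) = cong (_+_ (+ 0)) (∑-zero n)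

  ∑-distrib-+ : ∀ n (h h′ : ℕ → ℤ) → ∑ n (λ k → h k + h′ k) ≡ ∑ n h + ∑ n h′
  ∑-distrib-+ zero    h h′ = refl
  ∑-distrib-+ (suc n) h h′ = begin
      h 0 + h′ 0 + ∑ n (λ k → h (suc k) + h′ (suc k))
    ≡⟨ cong (_+_ (h 0 + h′ 0)) (∑-distrib-+ n (h ∘ suc) (h′ ∘ suc)) ⟩
      h 0 + h′ 0 + (∑ n (h ∘ suc) + ∑ n (h′ ∘ suc))
    ≡⟨ +-interchange (h 0) (h′ 0) _ _ ⟩
      h 0 + ∑ n (h ∘ suc) + (h′ 0 + ∑ n (h′ ∘ suc)) ∎
    where open ≡-Reasoning

  ∑-*ˡ : ∀ n c (h : ℕ → ℤ) → ∑ n (λ k → c * h k) ≡ c * ∑ n h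
  ∑-*ˡ zero    c h = refl
  ∑-*ˡ (suc n) c h = trans (cong (_+_ (c * h 0)) (∑-*ˡ n c (h ∘ suc))) (sym (ℤ.*-distribˡ-+ c (h 0) _))

  ∑-*ʳ : ∀ n c (h : ℕ → ℤ) → ∑ n (λ k → h k * c) ≡ ∑ n h * c
  ∑-*ʳ n c h = trans (∑-cong n (λ k → ℤ.*-comm (h k) c)) (trans (∑-*ˡ n c h) (ℤ.*-comm c _))

  ∑-suc : ∀ n (h : ℕ → ℤ) → ∑ (suc n) h ≡ ∑ n h + h (suc n)
  ∑-suc zero    h = refl
  ∑-suc (suc n) h = trans (cong (_+_ (h 0)) (∑-suc n (h ∘ suc))) (sym (ℤ.+-assoc (h 0) _ _))

  ∑-telescope : ∀ n (g : ℕ → ℤ) → ∑ n (λ k → g k - g (suc k)) ≡ g 0 - g (suc n)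
  ∑-telescope zero    g = refl
  ∑-telescope (suc n) g = begin
      g 0 - g 1 + ∑ n (λ k → g (suc k) - g (suc (suc k)))
    ≡⟨ cong (_+_ (g 0 - g 1)) (∑-telescope n (g ∘ suc)) ⟩
      g 0 - g 1 + (g 1 - g (suc (suc n)))
    ≡⟨ cancel (g 0) (g 1) (g (suc (suc n))) ⟩
      g 0 - g (suc (suc n)) ∎
    where
    open ≡-Reasoning
    cancel : ∀ x y z → x - y + (y - z) ≡ x - z
    cancel = ℤ-solve-∀

  ∑-reverse : ∀ n (h : ℕ → ℤ) → ∑ n h ≡ ∑ n (λ k → h (n ∸ k))
  ∑-reverse zero    h = refl
  ∑-reverse (suc n) h = begin
      h 0 + ∑ n (h ∘ suc)
    ≡⟨ cong (_+_ (h 0)) (∑-reverse n (h ∘ suc)) ⟩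
      h 0 + ∑ n (λ k → h (suc (n ∸ k)))
    ≡⟨ ℤ.+-comm (h 0) _ ⟩
      ∑ n (λ k → h (suc (n ∸ k))) + h 0
    ≡⟨ cong₂ _+_ (∑-cong-≤ n (λ k k≤n → cong h (sym (ℕ.+-∸-assoc 1 k≤n))))
                 (cong h (sym (ℕ.n∸n≡0 n))) ⟩
      ∑ n (λ k → h (suc n ∸ k)) + h (suc n ∸ suc n)
    ≡⟨ ∑-suc n (λ k → h (suc n ∸ k)) ⟨
      ∑ (suc n) (λ k → h (suc n ∸ k)) ∎
    where open ≡-Reasoning

  ∑-triangle : ∀ n (F : ℕ → ℕ → ℤ) →
    ∑ n (λ k → ∑ k (λ j → F j k)) ≡ ∑ n (λ j → ∑ (n ∸ j) (λ i → F j (j +ℕ i)))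
  ∑-triangle zero    F = refl
  ∑-triangle (suc n) F = begin
      ∑ (suc n) (λ k → ∑ k (λ j → F j k))
    ≡⟨ ∑-suc n _ ⟩
      ∑ n (λ k → ∑ k (λ j → F j k)) + ∑ (suc n) (λ j → F j (suc n))
    ≡⟨ cong₂ _+_ (∑-triangle n F) (∑-suc n _) ⟩
      R + (∑ n (λ j → F j (suc n)) + F (suc n) (suc n))
    ≡⟨ ℤ.+-assoc R _ _ ⟨
      R + ∑ n (λ j → F j (suc n)) + F (suc n) (suc n)
    ≡⟨ cong₂ _+_ (∑-distrib-+ n _ _) diagonal ⟨
      ∑ n (λ j → ∑ (n ∸ j) (λ i → F j (j +ℕ i)) + F j (suc n))
        + ∑ (suc n ∸ suc n) (λ i → F (suc n) (suc n +ℕ i))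
    ≡⟨ cong (_+ ∑ (suc n ∸ suc n) (λ i → F (suc n) (suc n +ℕ i))) (∑-cong-≤ n row) ⟩
      ∑ n (λ j → ∑ (suc n ∸ j) (λ i → F j (j +ℕ i)))
        + ∑ (suc n ∸ suc n) (λ i → F (suc n) (suc n +ℕ i))
    ≡⟨ ∑-suc n (λ j → ∑ (suc n ∸ j) (λ i → F j (j +ℕ i))) ⟨
      ∑ (suc n) (λ j → ∑ (suc n ∸ j) (λ i → F j (j +ℕ i))) ∎
    where
    open ≡-Reasoning
    R : ℤ
    R = ∑ n (λ j → ∑ (n ∸ j) (λ i → F j (j +ℕ i)))
    diagonal : ∑ (suc n ∸ suc n) (λ i → F (suc n) (suc n +ℕ i)) ≡ F (suc n) (suc n)
    diagonal = trans (cong (λ z → ∑ z (λ i → F (suc n) (suc n +ℕ i))) (ℕ.n∸n≡0 n))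
                     (cong (F (suc n)) (ℕ.+-identityʳ (suc n)))
    row : ∀ j → j ≤ℕ n →
          ∑ (n ∸ j) (λ i → F j (j +ℕ i)) + F j (suc n) ≡ ∑ (suc n ∸ j) (λ i → F j (j +ℕ i))
    row j j≤n = begin
        ∑ (n ∸ j) (λ i → F j (j +ℕ i)) + F j (suc n)
      ≡⟨ cong (λ z → ∑ (n ∸ j) (λ i → F j (j +ℕ i)) + F j z)
              (trans (ℕ.+-suc j (n ∸ j)) (cong suc (ℕ.m+[n∸m]≡n j≤n))) ⟨
        ∑ (n ∸ j) (λ i → F j (j +ℕ i)) + F j (j +ℕ suc (n ∸ j))
      ≡⟨ ∑-suc (n ∸ j) (λ i → F j (j +ℕ i)) ⟨
        ∑ (suc (n ∸ j)) (λ i → F j (j +ℕ i))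
      ≡⟨ cong (λ z → ∑ z (λ i → F j (j +ℕ i))) (ℕ.+-∸-assoc 1 j≤n) ⟨
        ∑ (suc n ∸ j) (λ i → F j (j +ℕ i)) ∎

  ∑-swap : ∀ a b (F : ℕ → ℕ → ℤ) → ∑ a (λ i → ∑ b (F i)) ≡ ∑ b (λ j → ∑ a (λ i → F i j))
  ∑-swap zero    b F = refl
  ∑-swap (suc a) b F = trans (cong (_+_ (∑ b (F 0))) (∑-swap a b (F ∘ suc)))
                             (sym (∑-distrib-+ b (F 0) (λ j → ∑ a (λ i → F (suc i) j))))

  ∑-δ : ∀ n a (h : ℕ → ℤ) → a ≤ℕ n → ∑ n (λ k → δ k a * h k) ≡ h a
  ∑-δ zero    zero    h _ = ℤ.*-identityˡ (h 0)
  ∑-δ (suc n) zero    h _ = begin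
      + 1 * h 0 + ∑ n (λ k → + 0 * h (suc k))
    ≡⟨ cong₂ _+_ (ℤ.*-identityˡ (h 0)) (trans (∑-cong n (λ k → ℤ.*-zeroˡ (h (suc k)))) (∑-zero n)) ⟩
      h 0 + + 0
    ≡⟨ ℤ.+-identityʳ (h 0) ⟩
      h 0 ∎
    where open ≡-Reasoning
  ∑-δ (suc n) (suc a) h (s≤s a≤n) = trans (ℤ.+-identityˡ _) (∑-δ n a (h ∘ suc) a≤n)

  ∑-δ-beyond : ∀ n a (h : ℕ → ℤ) → n <ℕ a → ∑ n (λ k → δ k a * h k) ≡ + 0
  ∑-δ-beyond zero    (suc a) h _         = refl
  ∑-δ-beyond (suc n) (suc a) h (s≤s n<a) = trans (ℤ.+-identityˡ _) (∑-δ-beyond n a (h ∘ suc) n<a)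

  infix  4 _≈_
  infixl 6 _⊕_

  _⊕_ : Series → Series → Series
  (f ⊕ g) n = f n + g n

  ⊖_ : Series → Series
  (⊖ f) n = - f n

  𝟘 : Series
  𝟘 _ = + 0

  _≈_ : Series → Series → Set
  f ≈ g = ∀ n → f n ≡ g n

  ⊕-cong : ∀ {f f′ g g′} → f ≈ f′ → g ≈ g′ → f ⊕ g ≈ f′ ⊕ g′
  ⊕-cong f≈f′ g≈g′ n = cong₂ _+_ (f≈f′ n) (g≈g′ n)

  ⊖-cong : ∀ {f f′} → f ≈ f′ → ⊖ f ≈ ⊖ f′
  ⊖-cong f≈f′ n = cong -_ (f≈f′ n)

  ⊛-∑ : ∀ f g n → (f ⊛ g) n ≡ ∑ n (λ k → f k * g (n ∸ k))
  ⊛-∑ f g n = sumℤ-map-upTo n (λ k → f k * g (n ∸ k))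

  ⊛-constant-term : ∀ f g → (f ⊛ g) 0 ≡ f 0 * g 0
  ⊛-constant-term f g = ⊛-∑ f g 0

  ⊛-cong : ∀ {f f′ g g′} → f ≈ f′ → g ≈ g′ → f ⊛ g ≈ f′ ⊛ g′
  ⊛-cong {f} {f′} {g} {g′} f≈f′ g≈g′ n = begin
      (f ⊛ g) n
    ≡⟨ ⊛-∑ f g n ⟩
      ∑ n (λ k → f k * g (n ∸ k))
    ≡⟨ ∑-cong n (λ k → cong₂ _*_ (f≈f′ k) (g≈g′ (n ∸ k))) ⟩
      ∑ n (λ k → f′ k * g′ (n ∸ k))
    ≡⟨ ⊛-∑ f′ g′ n ⟨
      (f′ ⊛ g′) n ∎
    where open ≡-Reasoning

  ⊛-congˡ : ∀ h {f g} → f ≈ g → h ⊛ f ≈ h ⊛ g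
  ⊛-congˡ h = ⊛-cong {h} {h} (λ _ → refl)

  ⊛-congʳ : ∀ h {f g} → f ≈ g → f ⊛ h ≈ g ⊛ h
  ⊛-congʳ h f≈g = ⊛-cong f≈g (λ _ → refl)

  ⊛-comm : ∀ f g → f ⊛ g ≈ g ⊛ f
  ⊛-comm f g n = begin
      (f ⊛ g) n
    ≡⟨ ⊛-∑ f g n ⟩
      ∑ n (λ k → f k * g (n ∸ k))
    ≡⟨ ∑-reverse n _ ⟩
      ∑ n (λ k → f (n ∸ k) * g (n ∸ (n ∸ k)))
    ≡⟨ ∑-cong-≤ n (λ k k≤n → trans (cong (λ z → f (n ∸ k) * g z) (ℕ.m∸[m∸n]≡n k≤n))
                                    (ℤ.*-comm (f (n ∸ k)) (g k))) ⟩
      ∑ n (λ k → g k * f (n ∸ k))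
    ≡⟨ ⊛-∑ g f n ⟨
      (g ⊛ f) n ∎
    where open ≡-Reasoning

  ⊛-assoc : ∀ f g h → (f ⊛ g) ⊛ h ≈ f ⊛ (g ⊛ h)
  ⊛-assoc f g h n = begin
      ((f ⊛ g) ⊛ h) n
    ≡⟨ ⊛-∑ (f ⊛ g) h n ⟩
      ∑ n (λ k → (f ⊛ g) k * h (n ∸ k))
    ≡⟨ ∑-cong n (λ k → trans (cong (_* h (n ∸ k)) (⊛-∑ f g k)) (sym (∑-*ʳ k (h (n ∸ k)) _))) ⟩
      ∑ n (λ k → ∑ k (λ j → f j * g (k ∸ j) * h (n ∸ k)))
    ≡⟨ ∑-triangle n (λ j k → f j * g (k ∸ j) * h (n ∸ k)) ⟩
      ∑ n (λ j → ∑ (n ∸ j) (λ i → f j * g (j +ℕ i ∸ j) * h (n ∸ (j +ℕ i))))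
    ≡⟨ ∑-cong n (λ j → trans (∑-cong (n ∸ j) (λ i → trans (ℤ.*-assoc (f j) _ _)
                               (cong₂ (λ a b → f j * (g a * h b)) (ℕ.m+n∸m≡n j i) (sym (ℕ.∸-+-assoc n j i)))))
                             (∑-*ˡ (n ∸ j) (f j) _)) ⟩
      ∑ n (λ j → f j * ∑ (n ∸ j) (λ i → g i * h (n ∸ j ∸ i)))
    ≡⟨ ∑-cong n (λ j → cong (f j *_) (⊛-∑ g h (n ∸ j))) ⟨
      ∑ n (λ j → f j * (g ⊛ h) (n ∸ j))
    ≡⟨ ⊛-∑ f (g ⊛ h) n ⟨
      (f ⊛ (g ⊛ h)) n ∎
    where open ≡-Reasoning

  ⊛-distribˡ : ∀ f g h → f ⊛ (g ⊕ h) ≈ f ⊛ g ⊕ f ⊛ h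
  ⊛-distribˡ f g h n = begin
      (f ⊛ (g ⊕ h)) n
    ≡⟨ ⊛-∑ f (g ⊕ h) n ⟩
      ∑ n (λ k → f k * (g (n ∸ k) + h (n ∸ k)))
    ≡⟨ ∑-cong n (λ k → ℤ.*-distribˡ-+ (f k) _ _) ⟩
      ∑ n (λ k → f k * g (n ∸ k) + f k * h (n ∸ k))
    ≡⟨ ∑-distrib-+ n _ _ ⟩
      ∑ n (λ k → f k * g (n ∸ k)) + ∑ n (λ k → f k * h (n ∸ k))
    ≡⟨ cong₂ _+_ (⊛-∑ f g n) (⊛-∑ f h n) ⟨
      (f ⊛ g ⊕ f ⊛ h) n ∎
    where open ≡-Reasoning

  ⊛-distribʳ : ∀ f g h → (g ⊕ h) ⊛ f ≈ g ⊛ f ⊕ h ⊛ f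
  ⊛-distribʳ f g h n = trans (⊛-comm (g ⊕ h) f n)
    (trans (⊛-distribˡ f g h n) (cong₂ _+_ (⊛-comm f g n) (⊛-comm f h n)))

  ⊛-zeroʳ : ∀ f → f ⊛ 𝟘 ≈ 𝟘
  ⊛-zeroʳ f n = trans (⊛-∑ f 𝟘 n) (trans (∑-cong n (λ k → ℤ.*-zeroʳ (f k))) (∑-zero n))

  ≡⇒≈ : ∀ {f g} → f ≡ g → f ≈ g
  ≡⇒≈ refl _ = refl

  ⊛-zeroˡ : ∀ f → 𝟘 ⊛ f ≈ 𝟘
  ⊛-zeroˡ f n = trans (⊛-comm 𝟘 f n) (⊛-zeroʳ f n)

  oneMinusQ-0 : oneMinusQ 0 ≈ 𝟘
  oneMinusQ-0 n = ℤ.+-inverseʳ (δ n 0)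

  ⊛-distrib-∑ : ∀ f N (s : ℕ → Series) → f ⊛ (λ n → ∑ N (λ k → s k n)) ≈ (λ n → ∑ N (λ k → (f ⊛ s k) n))
  ⊛-distrib-∑ f zero    s n = refl
  ⊛-distrib-∑ f (suc N) s n = trans (⊛-distribˡ f (s 0) (λ n → ∑ N (λ k → s (suc k) n)) n)
                                    (cong (_+_ ((f ⊛ s 0) n)) (⊛-distrib-∑ f N (s ∘ suc) n))

  qpow-⊛ : ∀ a f n → a ≤ℕ n → (qpow a ⊛ f) n ≡ f (n ∸ a)
  qpow-⊛ a f n a≤n = trans (⊛-∑ (qpow a) f n) (∑-δ n a (λ k → f (n ∸ k)) a≤n)

  qpow-⊛-< : ∀ a f n → n <ℕ a → (qpow a ⊛ f) n ≡ + 0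
  qpow-⊛-< a f n n<a = trans (⊛-∑ (qpow a) f n) (∑-δ-beyond n a (λ k → f (n ∸ k)) n<a)

  ⊛-identityˡ : ∀ f → oneS ⊛ f ≈ f
  ⊛-identityˡ f n = qpow-⊛ 0 f n z≤n

  ⊛-identityʳ : ∀ f → f ⊛ oneS ≈ f
  ⊛-identityʳ f n = trans (⊛-comm f oneS n) (⊛-identityˡ f n)

  δ-shift : ∀ a b n → a ≤ℕ n → δ (n ∸ a) b ≡ δ n (a +ℕ b)
  δ-shift zero    b n       _         = refl
  δ-shift (suc a) b (suc n) (s≤s a≤n) = δ-shift a b n a≤n

  δ-< : ∀ n c → n <ℕ c → δ n c ≡ + 0
  δ-< zero    (suc c) _         = refl
  δ-< (suc n) (suc c) (s≤s n<c) = δ-< n c n<c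

  qpow-+ : ∀ a b → qpow a ⊛ qpow b ≈ qpow (a +ℕ b)
  qpow-+ a b n with a ℕ.≤? n
  ... | yes a≤n = trans (qpow-⊛ a (qpow b) n a≤n) (δ-shift a b n a≤n)
  ... | no  a≰n = trans (qpow-⊛-< a (qpow b) n (ℕ.≰⇒> a≰n))
                        (sym (δ-< n (a +ℕ b) (ℕ.<-≤-trans (ℕ.≰⇒> a≰n) (ℕ.m≤m+n a b))))

  series-commutativeRing : CommutativeRing _ _
  series-commutativeRing = record
    { Carrier = Series
    ; _≈_ = _≈_
    ; _+_ = _⊕_
    ; _*_ = _⊛_
    ; -_ = ⊖_
    ; 0# = 𝟘
    ; 1# = oneS
    ; isCommutativeRing = record
      { isRing = record
        { +-isAbelianGroup = record
          { isGroup = record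
            { isMonoid = record
              { isSemigroup = record
                { isMagma = record
                  { isEquivalence = record
                    { refl = λ _ → refl ; sym = λ e n → sym (e n) ; trans = λ e e′ n → trans (e n) (e′ n) }
                  ; ∙-cong = λ e e′ n → cong₂ _+_ (e n) (e′ n) }
                ; assoc = λ f g h n → ℤ.+-assoc (f n) (g n) (h n) }
              ; identity = (λ f n → ℤ.+-identityˡ (f n)) , (λ f n → ℤ.+-identityʳ (f n)) }
            ; inverse = (λ f n → ℤ.+-inverseˡ (f n)) , (λ f n → ℤ.+-inverseʳ (f n))
            ; ⁻¹-cong = λ e n → cong -_ (e n) }
          ; comm = λ f g n → ℤ.+-comm (f n) (g n) }
        ; *-cong = ⊛-cong
        ; *-assoc = ⊛-assoc
        ; *-identity = ⊛-identityˡ , ⊛-identityʳ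
        ; distrib = ⊛-distribˡ , ⊛-distribʳ }
      ; *-comm = ⊛-comm } }

  open CommutativeRing series-commutativeRing public
    using () renaming (setoid to ≈-setoid; refl to ≈-refl; sym to ≈-sym; trans to ≈-trans)

  module ≈-Reasoning = SetoidReasoning ≈-setoid

  -- The solver reads con c as cst c; written this way cst (+ 1) is definitionally oneS.
  cst : ℤ → Series
  cst c n = if n ≡ᵇ 0 then c else + 0

  cst-⊛ : ∀ c f → cst c ⊛ f ≈ (λ n → c * f n)
  cst-⊛ c f n = trans (⊛-∑ (cst c) f n) (pick n)
    where
    pick : ∀ n → ∑ n (λ k → cst c k * f (n ∸ k)) ≡ c * f n
    pick zero    = refl
    pick (suc n) = begin
        c * f (suc n) + ∑ n (λ k → + 0 * f (n ∸ k))
      ≡⟨ cong (_+_ (c * f (suc n))) (trans (∑-cong n (λ k → ℤ.*-zeroˡ (f (n ∸ k)))) (∑-zero n)) ⟩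
        c * f (suc n) + + 0
      ≡⟨ ℤ.+-identityʳ _ ⟩
        c * f (suc n) ∎
      where open ≡-Reasoning

  cst-homomorphism : CommutativeRing.rawRing ℤ.+-*-commutativeRing
                       -Raw-AlmostCommutative⟶ fromCommutativeRing series-commutativeRing
  cst-homomorphism = record
    { ⟦_⟧    = cst
    ; +-homo = λ { a b zero → refl ; a b (suc n) → refl }
    ; *-homo = λ a b n → sym (trans (cst-⊛ a (cst b) n) (homo a b n))
    ; -‿homo = λ { a zero → refl ; a (suc n) → refl }
    ; 0-homo = λ { zero → refl ; (suc n) → refl }
    ; 1-homo = λ _ → refl }
    where
    homo : ∀ a b n → a * cst b n ≡ cst (a * b) n
    homo a b zero    = refl
    homo a b (suc n) = ℤ.*-zeroʳ a

  cst-≟ : ∀ a b → Maybe (cst a ≈ cst b)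
  cst-≟ a b with a ℤ.≟ b
  ... | yes refl = just (λ _ → refl)
  ... | no  _    = nothing

  module SeriesSolver = Algebra.Solver.Ring
    (CommutativeRing.rawRing ℤ.+-*-commutativeRing) (fromCommutativeRing series-commutativeRing)
    cst-homomorphism cst-≟

  invRev-applyUpTo : ∀ f n → invRev f n ≡ applyUpTo (λ k → inv f (n ∸ k)) (suc n)
  invRev-applyUpTo f zero    = refl
  invRev-applyUpTo f (suc n) = cong (inv f (suc n) ∷_) (invRev-applyUpTo f n)

  zipWith-*-applyUpTo : ∀ (u v : ℕ → ℤ) m →
    zipWith _*_ (applyUpTo u m) (applyUpTo v m) ≡ applyUpTo (λ k → u k * v k) m
  zipWith-*-applyUpTo u v zero    = refl
  zipWith-*-applyUpTo u v (suc m) = cong (u 0 * v 0 ∷_) (zipWith-*-applyUpTo (u ∘ suc) (v ∘ suc) m)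

  inv-suc : ∀ f n → inv f (suc n) ≡ - ∑ n (λ k → f (suc k) * inv f (n ∸ k))
  inv-suc f n = cong -_ (begin
      sumℤ (zipWith _*_ (map f (applyUpTo suc (suc n))) (invRev f n))
    ≡⟨ cong₂ (λ a b → sumℤ (zipWith _*_ a b)) (map-applyUpTo suc f (suc n)) (invRev-applyUpTo f n) ⟩
      sumℤ (zipWith _*_ (applyUpTo (f ∘ suc) (suc n)) (applyUpTo (λ k → inv f (n ∸ k)) (suc n)))
    ≡⟨ cong sumℤ (zipWith-*-applyUpTo (f ∘ suc) (λ k → inv f (n ∸ k)) (suc n)) ⟩
      sumℤ (applyUpTo (λ k → f (suc k) * inv f (n ∸ k)) (suc n))
    ≡⟨ sumℤ-applyUpTo n _ ⟩
      ∑ n (λ k → f (suc k) * inv f (n ∸ k)) ∎)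
    where open ≡-Reasoning

  ⊛-inverseʳ : ∀ f → f 0 ≡ + 1 → f ⊛ inv f ≈ oneS
  ⊛-inverseʳ f f₀≡1 zero    = trans (⊛-constant-term f (inv f)) (cong (_* + 1) f₀≡1)
  ⊛-inverseʳ f f₀≡1 (suc n) = begin
      (f ⊛ inv f) (suc n)
    ≡⟨ ⊛-∑ f (inv f) (suc n) ⟩
      f 0 * inv f (suc n) + X
    ≡⟨ cong₂ (λ a b → a * b + X) f₀≡1 (inv-suc f n) ⟩
      + 1 * - X + X
    ≡⟨ cong (_+ X) (ℤ.*-identityˡ (- X)) ⟩
      - X + X
    ≡⟨ ℤ.+-inverseˡ X ⟩
      + 0 ∎
    where
    open ≡-Reasoning
    X : ℤ
    X = ∑ n (λ k → f (suc k) * inv f (n ∸ k))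

  inv-unique : ∀ A X B → A 0 ≡ + 1 → A ⊛ X ≈ B → X ≈ inv A ⊛ B
  inv-unique A X B A₀≡1 AX≈B = begin
      X
    ≈⟨ ⊛-identityˡ X ⟨
      oneS ⊛ X
    ≈⟨ ⊛-congʳ X (≈-trans (⊛-comm (inv A) A) (⊛-inverseʳ A A₀≡1)) ⟨
      (inv A ⊛ A) ⊛ X
    ≈⟨ ⊛-assoc (inv A) A X ⟩
      inv A ⊛ (A ⊛ X)
    ≈⟨ ⊛-congˡ (inv A) AX≈B ⟩
      inv A ⊛ B ∎
    where open ≈-Reasoning

  inv-factor : ∀ A B w → A 0 ≡ + 1 → B 0 ≡ + 1 → B ≈ A ⊛ w → inv A ≈ w ⊛ inv B
  inv-factor A B w A₀≡1 B₀≡1 B≈Aw = ≈-sym (≈-trans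
    (inv-unique A (w ⊛ inv B) oneS A₀≡1
      (≈-trans (≈-sym (⊛-assoc A w (inv B)))
               (≈-trans (⊛-congʳ (inv B) (≈-sym B≈Aw)) (⊛-inverseʳ B B₀≡1))))
    (⊛-identityʳ (inv A)))

  recurrence-unique : ∀ (A B F G : ℕ → Series) → (∀ m → A m 0 ≡ + 1) →
    (∀ m → A m ⊛ F (suc m) ≈ B m ⊛ F m) → (∀ m → A m ⊛ G (suc m) ≈ B m ⊛ G m) →
    F 0 ≈ G 0 → ∀ m → F m ≈ G m
  recurrence-unique A B F G A₀≡1 recF recG F₀≈G₀ zero    = F₀≈G₀
  recurrence-unique A B F G A₀≡1 recF recG F₀≈G₀ (suc m) = begin
      F (suc m)
    ≈⟨ inv-unique (A m) (F (suc m)) _ (A₀≡1 m) (recF m) ⟩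
      inv (A m) ⊛ (B m ⊛ F m)
    ≈⟨ ⊛-congˡ (inv (A m)) (⊛-congˡ (B m) (recurrence-unique A B F G A₀≡1 recF recG F₀≈G₀ m)) ⟩
      inv (A m) ⊛ (B m ⊛ G m)
    ≈⟨ inv-unique (A m) (G (suc m)) _ (A₀≡1 m) (recG m) ⟨
      G (suc m) ∎
    where open ≈-Reasoning


module DoubleSum where

  open PowerSeries
  open BooleanComparisons
  open import Data.Nat using (zero; suc; _∸_; _≤ᵇ_; _≡ᵇ_; _/_; s≤s)
    renaming (_+_ to _+ℕ_; _*_ to _*ℕ_; _≤_ to _≤ℕ_; _<_ to _<ℕ_)
  import Data.Nat.Properties as ℕ
  open import Data.Nat.DivMod using (m*n/n≡m)
  open import Data.Nat.Tactic.RingSolver using (solve-∀)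
  open import Data.Integer using (ℤ; -_; _+_; _-_; _*_)
  import Data.Integer.Properties as ℤ
  open import Data.List using ([]; _∷_)
  open import Data.List.NonEmpty as List⁺ using (_∷_; foldr₁)
  open import Data.Bool using (true; false; if_then_else_)
  open import Data.Sum using (inj₁; inj₂)
  open import Relation.Nullary using (yes; no)
  open import Relation.Binary.Definitions using (tri<; tri≈; tri>)
  open import Relation.Binary.PropositionalEquality
  open SeriesSolver using (solve; _:+_; _:-_; _:*_; _:=_; con)

  pentagonal : ℕ → ℕ
  pentagonal zero    = 0
  pentagonal (suc n) = pentagonal n +ℕ (3 *ℕ n +ℕ 1)

  exponent : ℕ → ℕ → ℕ
  exponent n₁ n₂ = 4 *ℕ n₂ *ℕ n₂ +ℕ pentagonal n₁ +ℕ 4 *ℕ n₂ *ℕ n₁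

  denominator : ℕ → ℕ → Series
  denominator n₁ n₂ = poch 1 1 n₁ ⊛ poch 4 4 n₂

  summand : ℕ → ℕ → Series
  summand n₁ n₂ = qpow (exponent n₁ n₂) ⊛ inv (denominator n₁ n₂)

  poch-constant-term : ∀ a b n → poch (suc a) b n 0 ≡ + 1
  poch-constant-term a b zero    = refl
  poch-constant-term a b (suc n) = trans (⊛-constant-term (poch (suc a) b n) (oneMinusQ (suc a +ℕ b *ℕ n)))
                                         (cong (_* + 1) (poch-constant-term a b n))

  denominator-constant-term : ∀ n₁ n₂ → denominator n₁ n₂ 0 ≡ + 1
  denominator-constant-term n₁ n₂ = trans (⊛-constant-term (poch 1 1 n₁) (poch 4 4 n₂))
    (cong₂ _*_ (poch-constant-term 0 1 n₁) (poch-constant-term 3 4 n₂))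

  inv-denominator-suc₁ : ∀ n₁ n₂ →
    inv (denominator n₁ n₂) ≈ oneMinusQ (suc n₁) ⊛ inv (denominator (suc n₁) n₂)
  inv-denominator-suc₁ n₁ n₂ = inv-factor _ _ _ (denominator-constant-term n₁ n₂)
    (denominator-constant-term (suc n₁) n₂)
    (≈-trans (⊛-congʳ (poch 4 4 n₂) (⊛-congˡ (poch 1 1 n₁) (λ n → cong (λ d → oneMinusQ (suc d) n) (ℕ.+-identityʳ n₁))))
             (swap (poch 1 1 n₁) (oneMinusQ (suc n₁)) (poch 4 4 n₂)))
    where
    swap : ∀ P w Q → (P ⊛ w) ⊛ Q ≈ (P ⊛ Q) ⊛ w
    swap = solve 3 (λ P w Q → (P :* w) :* Q := (P :* Q) :* w) (λ _ → refl)

  inv-denominator-suc₂ : ∀ n₁ n₂ →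
    inv (denominator n₁ n₂) ≈ oneMinusQ (4 +ℕ 4 *ℕ n₂) ⊛ inv (denominator n₁ (suc n₂))
  inv-denominator-suc₂ n₁ n₂ = inv-factor _ _ _ (denominator-constant-term n₁ n₂)
    (denominator-constant-term n₁ (suc n₂))
    (≈-sym (⊛-assoc (poch 1 1 n₁) (poch 4 4 n₂) (oneMinusQ (4 +ℕ 4 *ℕ n₂))))

  qpow-foldr₁ : ∀ xs → qpow (foldr₁ _+ℕ_ xs) ≈ foldr₁ _⊛_ (List⁺.map qpow xs)
  qpow-foldr₁ (x ∷ xs) = go x xs
    where
    go : ∀ x xs → qpow (foldr₁ _+ℕ_ (x ∷ xs)) ≈ foldr₁ _⊛_ (List⁺.map qpow (x ∷ xs))
    go x []       = ≈-refl
    go x (y ∷ ys) = ≈-trans (≈-sym (qpow-+ x _)) (⊛-congˡ (qpow x) (go y ys))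

  qpow-as-product : ∀ {e} xs → e ≡ foldr₁ _+ℕ_ xs → qpow e ≈ foldr₁ _⊛_ (List⁺.map qpow xs)
  qpow-as-product xs refl = qpow-foldr₁ xs

  oneMinusQ-as-product : ∀ {d} xs → d ≡ foldr₁ _+ℕ_ xs → oneMinusQ d ≈ oneS ⊕ ⊖ foldr₁ _⊛_ (List⁺.map qpow xs)
  oneMinusQ-as-product xs d≡ n = cong (λ z → δ n 0 + - z) (qpow-as-product xs d≡ n)

  firstPartFactor : ℕ → Series
  firstPartFactor m = qpow (1 +ℕ 2 *ℕ m) ⊕ qpow (2 +ℕ (2 *ℕ m +ℕ 2 *ℕ m))

  correction : ℕ → ℕ → ℕ → Series
  correction m n₁ n₂ = qpow (1 +ℕ 2 *ℕ m) ⊛ (oneMinusQ n₁ ⊛ summand n₁ n₂)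

  -- The ring solver sees q-powers as atoms, so in the three identities below every exponent
  -- is first split into a sum of the atoms' exponents.
  summand-step-n₂≡0 : ∀ m → oneMinusQ (2 *ℕ suc m) ⊛ summand (suc m) 0
                          ≈ firstPartFactor m ⊛ summand m 0 ⊕ ⊖ correction m m 0
  summand-step-n₂≡0 m = begin
      oneMinusQ (2 *ℕ suc m) ⊛ summand (suc m) 0
    ≈⟨ ⊛-cong (oneMinusQ-as-product (m ∷ m ∷ 1 ∷ 1 ∷ []) (2[1+m]-split m))
              (⊛-congʳ C (qpow-as-product (pentagonal m ∷ m ∷ m ∷ m ∷ 1 ∷ []) (exponent[1+m,0]-split m (pentagonal m)))) ⟩
      (oneS ⊕ ⊖ (M ⊛ (M ⊛ (U ⊛ U)))) ⊛ ((B ⊛ (M ⊛ (M ⊛ (M ⊛ U)))) ⊛ C)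
    ≈⟨ identity B M U C ⟩
      (U ⊛ (M ⊛ M) ⊕ U ⊛ (U ⊛ (M ⊛ (M ⊛ (M ⊛ M))))) ⊛ Sₘ ⊕ ⊖ ((U ⊛ (M ⊛ M)) ⊛ ((oneS ⊕ ⊖ M) ⊛ Sₘ))
    ≈⟨ ⊕-cong (⊛-cong factor≈ summand≈) (⊖-cong (⊛-cong q²ᵐ⁺¹≈ (⊛-congˡ (oneMinusQ m) summand≈))) ⟨
      firstPartFactor m ⊛ summand m 0 ⊕ ⊖ correction m m 0 ∎
    where
    open ≈-Reasoning
    B M U C Sₘ : Series
    B = qpow (pentagonal m)
    M = qpow m
    U = qpow 1
    C = inv (denominator (suc m) 0)
    Sₘ = B ⊛ ((oneS ⊕ ⊖ (M ⊛ U)) ⊛ C)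
    2[1+m]-split : ∀ m → 2 *ℕ suc m ≡ m +ℕ (m +ℕ (1 +ℕ 1))
    2[1+m]-split = solve-∀
    exponent[1+m,0]-split : ∀ m p → 4 *ℕ 0 *ℕ 0 +ℕ (p +ℕ (3 *ℕ m +ℕ 1)) +ℕ 4 *ℕ 0 *ℕ suc m ≡ p +ℕ (m +ℕ (m +ℕ (m +ℕ 1)))
    exponent[1+m,0]-split = solve-∀
    1+2m-split : ∀ m → 1 +ℕ 2 *ℕ m ≡ 1 +ℕ (m +ℕ m)
    1+2m-split = solve-∀
    2+4m-split : ∀ m → 2 +ℕ (2 *ℕ m +ℕ 2 *ℕ m) ≡ 1 +ℕ (1 +ℕ (m +ℕ (m +ℕ (m +ℕ m))))
    2+4m-split = solve-∀
    exponent[m,0]-split : ∀ m p → 4 *ℕ 0 *ℕ 0 +ℕ p +ℕ 4 *ℕ 0 *ℕ m ≡ p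
    exponent[m,0]-split = solve-∀
    1+m-split : ∀ m → suc m ≡ m +ℕ 1
    1+m-split = solve-∀
    q²ᵐ⁺¹≈ : qpow (1 +ℕ 2 *ℕ m) ≈ U ⊛ (M ⊛ M)
    q²ᵐ⁺¹≈ = qpow-as-product (1 ∷ m ∷ m ∷ []) (1+2m-split m)
    factor≈ : firstPartFactor m ≈ U ⊛ (M ⊛ M) ⊕ U ⊛ (U ⊛ (M ⊛ (M ⊛ (M ⊛ M))))
    factor≈ = ⊕-cong q²ᵐ⁺¹≈ (qpow-as-product (1 ∷ 1 ∷ m ∷ m ∷ m ∷ m ∷ []) (2+4m-split m))
    summand≈ : summand m 0 ≈ Sₘ
    summand≈ = ⊛-cong (qpow-as-product (pentagonal m ∷ []) (exponent[m,0]-split m (pentagonal m)))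
                      (≈-trans (inv-denominator-suc₁ m 0) (⊛-congʳ C (oneMinusQ-as-product (m ∷ 1 ∷ []) (1+m-split m))))
    identity : ∀ B M U C →
      (oneS ⊕ ⊖ (M ⊛ (M ⊛ (U ⊛ U)))) ⊛ ((B ⊛ (M ⊛ (M ⊛ (M ⊛ U)))) ⊛ C) ≈
      (U ⊛ (M ⊛ M) ⊕ U ⊛ (U ⊛ (M ⊛ (M ⊛ (M ⊛ M))))) ⊛ (B ⊛ ((oneS ⊕ ⊖ (M ⊛ U)) ⊛ C))
        ⊕ ⊖ ((U ⊛ (M ⊛ M)) ⊛ ((oneS ⊕ ⊖ M) ⊛ (B ⊛ ((oneS ⊕ ⊖ (M ⊛ U)) ⊛ C))))
    identity = solve 4 (λ B M U C →
      (con (+ 1) :- M :* (M :* (U :* U))) :* ((B :* (M :* (M :* (M :* U)))) :* C) :=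
      (U :* (M :* M) :+ U :* (U :* (M :* (M :* (M :* M))))) :* (B :* ((con (+ 1) :- M :* U) :* C))
        :- U :* (M :* M) :* ((con (+ 1) :- M) :* (B :* ((con (+ 1) :- M :* U) :* C)))) (λ _ → refl)

  summand-step-n₁≡0 : ∀ j → oneMinusQ (2 *ℕ suc (suc (2 *ℕ j))) ⊛ summand 0 (suc j)
                          ≈ correction (suc (2 *ℕ j)) 1 j
  summand-step-n₁≡0 j = begin
      oneMinusQ (2 *ℕ suc (suc (2 *ℕ j))) ⊛ summand 0 (suc j)
    ≈⟨ ⊛-cong (oneMinusQ-as-product (4 *ℕ j +ℕ 3 ∷ 1 ∷ []) (2[2+2j]-split j))
              (⊛-cong (qpow-as-product (exponent 1 j ∷ 4 *ℕ j +ℕ 3 ∷ []) (exponent[0,1+j]-split j)) (inv-denominator-suc₁ 0 (suc j))) ⟩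
      (oneS ⊕ ⊖ (Y ⊛ U)) ⊛ ((X ⊛ Y) ⊛ ((oneS ⊕ ⊖ U) ⊛ C))
    ≈⟨ identity X Y U C ⟩
      Y ⊛ ((oneS ⊕ ⊖ U) ⊛ (X ⊛ ((oneS ⊕ ⊖ (Y ⊛ U)) ⊛ C)))
    ≈⟨ ⊛-cong (qpow-as-product (4 *ℕ j +ℕ 3 ∷ []) (1+2[1+2j]-split j)) (⊛-congˡ (oneMinusQ 1) summand≈) ⟨
      correction (suc (2 *ℕ j)) 1 j ∎
    where
    open ≈-Reasoning
    X Y U C : Series
    X = qpow (exponent 1 j)
    Y = qpow (4 *ℕ j +ℕ 3)
    U = qpow 1
    C = inv (denominator 1 (suc j))
    2[2+2j]-split : ∀ j → 2 *ℕ suc (suc (2 *ℕ j)) ≡ 4 *ℕ j +ℕ 3 +ℕ 1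
    2[2+2j]-split = solve-∀
    exponent[0,1+j]-split : ∀ j → 4 *ℕ suc j *ℕ suc j +ℕ 0 +ℕ 4 *ℕ suc j *ℕ 0 ≡ 4 *ℕ j *ℕ j +ℕ (0 +ℕ (3 *ℕ 0 +ℕ 1)) +ℕ 4 *ℕ j *ℕ 1 +ℕ (4 *ℕ j +ℕ 3)
    exponent[0,1+j]-split = solve-∀
    1+2[1+2j]-split : ∀ j → 1 +ℕ 2 *ℕ suc (2 *ℕ j) ≡ 4 *ℕ j +ℕ 3
    1+2[1+2j]-split = solve-∀
    4+4j-split : ∀ j → 4 +ℕ 4 *ℕ j ≡ 4 *ℕ j +ℕ 3 +ℕ 1
    4+4j-split = solve-∀
    summand≈ : summand 1 j ≈ X ⊛ ((oneS ⊕ ⊖ (Y ⊛ U)) ⊛ C)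
    summand≈ = ⊛-congˡ X (≈-trans (inv-denominator-suc₂ 1 j)
                                   (⊛-congʳ C (oneMinusQ-as-product (4 *ℕ j +ℕ 3 ∷ 1 ∷ []) (4+4j-split j))))
    identity : ∀ X Y U C → (oneS ⊕ ⊖ (Y ⊛ U)) ⊛ ((X ⊛ Y) ⊛ ((oneS ⊕ ⊖ U) ⊛ C))
                          ≈ Y ⊛ ((oneS ⊕ ⊖ U) ⊛ (X ⊛ ((oneS ⊕ ⊖ (Y ⊛ U)) ⊛ C)))
    identity = solve 4 (λ X Y U C →
      (con (+ 1) :- Y :* U) :* ((X :* Y) :* ((con (+ 1) :- U) :* C)) :=
      Y :* ((con (+ 1) :- U) :* (X :* ((con (+ 1) :- Y :* U) :* C)))) (λ _ → refl)

  summand-step-n₁>0 : ∀ a j → let m = 2 +ℕ (2 *ℕ j +ℕ a) in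
    oneMinusQ (2 *ℕ suc m) ⊛ summand (suc a) (suc j)
      ≈ firstPartFactor m ⊛ summand a (suc j) ⊕ (correction m (2 +ℕ a) j ⊕ ⊖ correction m a (suc j))
  summand-step-n₁>0 a j = begin
      oneMinusQ (2 *ℕ suc m) ⊛ summand (suc a) (suc j)
    ≈⟨ ⊛-cong (oneMinusQ-as-product (1 ∷ 1 ∷ a ∷ a ∷ 4 +ℕ 4 *ℕ j ∷ []) (2[1+m]-split a j))
              (⊛-cong (qpow-as-product (exponent a (suc j) ∷ 1 ∷ a ∷ a ∷ a ∷ 4 +ℕ 4 *ℕ j ∷ []) (exponent[1+a,1+j]-split a j (pentagonal a)))
                      (≈-trans (inv-denominator-suc₁ (suc a) (suc j)) (⊛-congʳ C 1-q^[a+2]≈))) ⟩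
      (oneS ⊕ ⊖ (U ⊛ (U ⊛ (A ⊛ (A ⊛ G))))) ⊛ ((X ⊛ (U ⊛ (A ⊛ (A ⊛ (A ⊛ G))))) ⊛ (Oₐ₊₂ ⊛ C))
    ≈⟨ regroup (oneS ⊕ ⊖ (U ⊛ (U ⊛ (A ⊛ (A ⊛ G))))) (U ⊛ (A ⊛ (A ⊛ (A ⊛ G)))) X (Oₐ₊₂ ⊛ C) ⟩
      ((oneS ⊕ ⊖ (U ⊛ (U ⊛ (A ⊛ (A ⊛ G))))) ⊛ (U ⊛ (A ⊛ (A ⊛ (A ⊛ G))))) ⊛ (X ⊛ (Oₐ₊₂ ⊛ C))
    ≈⟨ ⊛-congʳ (X ⊛ (Oₐ₊₂ ⊛ C)) (identity A U G) ⟩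
      (V ⊛ Oₐ₊₁ ⊕ (W ⊛ ((A ⊛ (A ⊛ U)) ⊛ O₄₊₄ⱼ) ⊕ ⊖ (W ⊛ (Oₐ ⊛ Oₐ₊₁)))) ⊛ (X ⊛ (Oₐ₊₂ ⊛ C))
    ≈⟨ distribute V Oₐ₊₁ W (A ⊛ (A ⊛ U)) O₄₊₄ⱼ Oₐ X Oₐ₊₂ C ⟩
      V ⊛ (X ⊛ (Oₐ₊₁ ⊛ (Oₐ₊₂ ⊛ C)))
        ⊕ (W ⊛ (Oₐ₊₂ ⊛ ((X ⊛ (A ⊛ (A ⊛ U))) ⊛ (O₄₊₄ⱼ ⊛ C))) ⊕ ⊖ (W ⊛ (Oₐ ⊛ (X ⊛ (Oₐ₊₁ ⊛ (Oₐ₊₂ ⊛ C))))))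
    ≈⟨ ⊕-cong (⊛-cong factor≈ summandₐ≈)
              (⊕-cong (⊛-cong q²ᵐ⁺¹≈ (⊛-cong 1-q^[a+2]≈ summandₐ₊₂≈))
                      (⊖-cong (⊛-cong q²ᵐ⁺¹≈ (⊛-congˡ (oneMinusQ a) summandₐ≈)))) ⟨
      firstPartFactor m ⊛ summand a (suc j) ⊕ (correction m (2 +ℕ a) j ⊕ ⊖ correction m a (suc j)) ∎
    where
    open ≈-Reasoning
    m : ℕ
    m = 2 +ℕ (2 *ℕ j +ℕ a)
    X A U G C W V Oₐ Oₐ₊₁ Oₐ₊₂ O₄₊₄ⱼ : Series
    X = qpow (exponent a (suc j))
    A = qpow a
    U = qpow 1
    G = qpow (4 +ℕ 4 *ℕ j)
    C = inv (denominator (2 +ℕ a) (suc j))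
    W = U ⊛ (A ⊛ (A ⊛ G))
    V = W ⊕ U ⊛ (U ⊛ (A ⊛ (A ⊛ (A ⊛ (A ⊛ (G ⊛ G))))))
    Oₐ = oneS ⊕ ⊖ A
    Oₐ₊₁ = oneS ⊕ ⊖ (A ⊛ U)
    Oₐ₊₂ = oneS ⊕ ⊖ (A ⊛ (U ⊛ U))
    O₄₊₄ⱼ = oneS ⊕ ⊖ G
    2[1+m]-split : ∀ a j → 2 *ℕ suc (2 +ℕ (2 *ℕ j +ℕ a)) ≡ 1 +ℕ (1 +ℕ (a +ℕ (a +ℕ (4 +ℕ 4 *ℕ j))))
    2[1+m]-split = solve-∀
    exponent[1+a,1+j]-split : ∀ a j p → 4 *ℕ suc j *ℕ suc j +ℕ (p +ℕ (3 *ℕ a +ℕ 1)) +ℕ 4 *ℕ suc j *ℕ suc a ≡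
           (4 *ℕ suc j *ℕ suc j +ℕ p +ℕ 4 *ℕ suc j *ℕ a) +ℕ (1 +ℕ (a +ℕ (a +ℕ (a +ℕ (4 +ℕ 4 *ℕ j)))))
    exponent[1+a,1+j]-split = solve-∀
    exponent[2+a,j]-split : ∀ a j p → 4 *ℕ j *ℕ j +ℕ (p +ℕ (3 *ℕ a +ℕ 1) +ℕ (3 *ℕ suc a +ℕ 1)) +ℕ 4 *ℕ j *ℕ suc (suc a) ≡
           (4 *ℕ suc j *ℕ suc j +ℕ p +ℕ 4 *ℕ suc j *ℕ a) +ℕ (a +ℕ (a +ℕ 1))
    exponent[2+a,j]-split = solve-∀
    1+2m-split : ∀ a j → 1 +ℕ 2 *ℕ (2 +ℕ (2 *ℕ j +ℕ a)) ≡ 1 +ℕ (a +ℕ (a +ℕ (4 +ℕ 4 *ℕ j)))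
    1+2m-split = solve-∀
    2+4m-split : ∀ a j → 2 +ℕ (2 *ℕ (2 +ℕ (2 *ℕ j +ℕ a)) +ℕ 2 *ℕ (2 +ℕ (2 *ℕ j +ℕ a))) ≡
           1 +ℕ (1 +ℕ (a +ℕ (a +ℕ (a +ℕ (a +ℕ ((4 +ℕ 4 *ℕ j) +ℕ (4 +ℕ 4 *ℕ j)))))))
    2+4m-split = solve-∀
    1+a-split : ∀ a → suc a ≡ a +ℕ 1
    1+a-split = solve-∀
    2+a-split : ∀ a → suc (suc a) ≡ a +ℕ (1 +ℕ 1)
    2+a-split = solve-∀
    1-q^[a+2]≈ : oneMinusQ (2 +ℕ a) ≈ Oₐ₊₂
    1-q^[a+2]≈ = oneMinusQ-as-product (a ∷ 1 ∷ 1 ∷ []) (2+a-split a)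
    q²ᵐ⁺¹≈ : qpow (1 +ℕ 2 *ℕ m) ≈ W
    q²ᵐ⁺¹≈ = qpow-as-product (1 ∷ a ∷ a ∷ 4 +ℕ 4 *ℕ j ∷ []) (1+2m-split a j)
    factor≈ : firstPartFactor m ≈ V
    factor≈ = ⊕-cong q²ᵐ⁺¹≈ (qpow-as-product (1 ∷ 1 ∷ a ∷ a ∷ a ∷ a ∷ 4 +ℕ 4 *ℕ j ∷ 4 +ℕ 4 *ℕ j ∷ []) (2+4m-split a j))
    summandₐ≈ : summand a (suc j) ≈ X ⊛ (Oₐ₊₁ ⊛ (Oₐ₊₂ ⊛ C))
    summandₐ≈ = ⊛-congˡ X (≈-trans (inv-denominator-suc₁ a (suc j))
      (⊛-cong (oneMinusQ-as-product (a ∷ 1 ∷ []) (1+a-split a))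
              (≈-trans (inv-denominator-suc₁ (suc a) (suc j)) (⊛-congʳ C 1-q^[a+2]≈))))
    summandₐ₊₂≈ : summand (2 +ℕ a) j ≈ (X ⊛ (A ⊛ (A ⊛ U))) ⊛ (O₄₊₄ⱼ ⊛ C)
    summandₐ₊₂≈ = ⊛-cong (qpow-as-product (exponent a (suc j) ∷ a ∷ a ∷ 1 ∷ []) (exponent[2+a,j]-split a j (pentagonal a)))
                         (inv-denominator-suc₂ (2 +ℕ a) j)
    regroup : ∀ P Q X R → P ⊛ ((X ⊛ Q) ⊛ R) ≈ (P ⊛ Q) ⊛ (X ⊛ R)
    regroup = solve 4 (λ P Q X R → P :* ((X :* Q) :* R) := (P :* Q) :* (X :* R)) (λ _ → refl)
    identity : ∀ A U G →
      (oneS ⊕ ⊖ (U ⊛ (U ⊛ (A ⊛ (A ⊛ G))))) ⊛ (U ⊛ (A ⊛ (A ⊛ (A ⊛ G)))) ≈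
      (U ⊛ (A ⊛ (A ⊛ G)) ⊕ U ⊛ (U ⊛ (A ⊛ (A ⊛ (A ⊛ (A ⊛ (G ⊛ G))))))) ⊛ (oneS ⊕ ⊖ (A ⊛ U))
        ⊕ ((U ⊛ (A ⊛ (A ⊛ G))) ⊛ ((A ⊛ (A ⊛ U)) ⊛ (oneS ⊕ ⊖ G))
           ⊕ ⊖ ((U ⊛ (A ⊛ (A ⊛ G))) ⊛ ((oneS ⊕ ⊖ A) ⊛ (oneS ⊕ ⊖ (A ⊛ U)))))
    identity = solve 3 (λ A U G →
      (con (+ 1) :- U :* (U :* (A :* (A :* G)))) :* (U :* (A :* (A :* (A :* G)))) :=
      (U :* (A :* (A :* G)) :+ U :* (U :* (A :* (A :* (A :* (A :* (G :* G))))))) :* (con (+ 1) :- A :* U)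
        :+ ((U :* (A :* (A :* G))) :* ((A :* (A :* U)) :* (con (+ 1) :- G))
           :- (U :* (A :* (A :* G))) :* ((con (+ 1) :- A) :* (con (+ 1) :- A :* U)))) (λ _ → refl)
    distribute : ∀ V O₁ W Q O₂ O₃ X O₄ C →
      (V ⊛ O₁ ⊕ (W ⊛ (Q ⊛ O₂) ⊕ ⊖ (W ⊛ (O₃ ⊛ O₁)))) ⊛ (X ⊛ (O₄ ⊛ C)) ≈
      V ⊛ (X ⊛ (O₁ ⊛ (O₄ ⊛ C))) ⊕ (W ⊛ (O₄ ⊛ ((X ⊛ Q) ⊛ (O₂ ⊛ C))) ⊕ ⊖ (W ⊛ (O₃ ⊛ (X ⊛ (O₁ ⊛ (O₄ ⊛ C))))))
    distribute = solve 9 (λ V O₁ W Q O₂ O₃ X O₄ C →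
      (V :* O₁ :+ (W :* (Q :* O₂) :- W :* (O₃ :* O₁))) :* (X :* (O₄ :* C)) :=
      V :* (X :* (O₁ :* (O₄ :* C))) :+ (W :* (O₄ :* ((X :* Q) :* (O₂ :* C))) :- W :* (O₃ :* (X :* (O₁ :* (O₄ :* C)))))) (λ _ → refl)

  summandAt : ℕ → ℕ → Series
  summandAt m k = if 2 *ℕ k ≤ᵇ m then summand (m ∸ 2 *ℕ k) k else 𝟘

  -- Shifted by one: correctionAt m (suc k) belongs to n₂ = k, so the corrections telescope in k.
  correctionAt : ℕ → ℕ → Series
  correctionAt m zero    = 𝟘
  correctionAt m (suc k) = if 2 *ℕ k ≤ᵇ m then correction m (m ∸ 2 *ℕ k) k else 𝟘

  summandAt-≤ : ∀ m k → 2 *ℕ k ≤ℕ m → summandAt m k ≡ summand (m ∸ 2 *ℕ k) k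
  summandAt-≤ m k 2k≤m rewrite ≤ᵇ-true 2k≤m = refl

  summandAt-> : ∀ m k → m <ℕ 2 *ℕ k → summandAt m k ≡ 𝟘
  summandAt-> m k m<2k rewrite ≤ᵇ-false m<2k = refl

  correctionAt-≤ : ∀ m k → 2 *ℕ k ≤ℕ m → correctionAt m (suc k) ≡ correction m (m ∸ 2 *ℕ k) k
  correctionAt-≤ m k 2k≤m rewrite ≤ᵇ-true 2k≤m = refl

  correctionAt-> : ∀ m k → m <ℕ 2 *ℕ k → correctionAt m (suc k) ≡ 𝟘
  correctionAt-> m k m<2k rewrite ≤ᵇ-false m<2k = refl

  SummandAtStep : ℕ → ℕ → Set
  SummandAtStep m k = oneMinusQ (2 *ℕ suc m) ⊛ summandAt (suc m) k
                        ≈ firstPartFactor m ⊛ summandAt m k ⊕ (correctionAt m k ⊕ ⊖ correctionAt m (suc k))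

  correctionAt-vanishes : ∀ m j → m ≤ℕ 2 *ℕ j → correctionAt m (suc j) ≈ 𝟘
  correctionAt-vanishes m j m≤2j with ℕ.m≤n⇒m<n∨m≡n m≤2j
  ... | inj₁ m<2j = ≡⇒≈ (correctionAt-> m j m<2j)
  ... | inj₂ refl = ≈-trans (≡⇒≈ (correctionAt-≤ m j ℕ.≤-refl)) (begin
      qpow (1 +ℕ 2 *ℕ m) ⊛ (oneMinusQ (m ∸ m) ⊛ summand (m ∸ m) j)
    ≈⟨ ⊛-congˡ (qpow (1 +ℕ 2 *ℕ m)) (⊛-congʳ (summand (m ∸ m) j) (≈-trans (≡⇒≈ (cong oneMinusQ (ℕ.n∸n≡0 m))) oneMinusQ-0)) ⟩
      qpow (1 +ℕ 2 *ℕ m) ⊛ (𝟘 ⊛ summand (m ∸ m) j)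
    ≈⟨ ⊛-congˡ (qpow (1 +ℕ 2 *ℕ m)) (⊛-zeroˡ (summand (m ∸ m) j)) ⟩
      qpow (1 +ℕ 2 *ℕ m) ⊛ 𝟘
    ≈⟨ ⊛-zeroʳ (qpow (1 +ℕ 2 *ℕ m)) ⟩
      𝟘 ∎)
    where open ≈-Reasoning

  summandAt-+ : ∀ k n₁ → summandAt (2 *ℕ k +ℕ n₁) k ≡ summand n₁ k
  summandAt-+ k n₁ = trans (summandAt-≤ _ k (ℕ.m≤m+n (2 *ℕ k) n₁))
                           (cong (λ x → summand x k) (ℕ.m+n∸m≡n (2 *ℕ k) n₁))

  correctionAt-+ : ∀ k n₁ → correctionAt (2 *ℕ k +ℕ n₁) (suc k) ≡ correction (2 *ℕ k +ℕ n₁) n₁ k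
  correctionAt-+ k n₁ = trans (correctionAt-≤ _ k (ℕ.m≤m+n (2 *ℕ k) n₁))
                              (cong (λ x → correction (2 *ℕ k +ℕ n₁) x k) (ℕ.m+n∸m≡n (2 *ℕ k) n₁))

  summandAt-step-n₂≡0 : ∀ m → SummandAtStep m 0
  summandAt-step-n₂≡0 m n = trans (summand-step-n₂≡0 m n)
    (cong (_+_ ((firstPartFactor m ⊛ summand m 0) n)) (sym (ℤ.+-identityˡ (- correction m m 0 n))))

  summandAt-step-n₁>0 : ∀ a j → SummandAtStep (2 +ℕ (2 *ℕ j +ℕ a)) (suc j)
  summandAt-step-n₁>0 a j = begin
      oneMinusQ (2 *ℕ suc m) ⊛ summandAt (suc m) (suc j)
    ≈⟨ ⊛-congˡ (oneMinusQ (2 *ℕ suc m)) (≡⇒≈ (trans (cong (λ x → summandAt x (suc j)) (1+m≡2[1+j]+[1+a] a j)) (summandAt-+ (suc j) (suc a)))) ⟩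
      oneMinusQ (2 *ℕ suc m) ⊛ summand (suc a) (suc j)
    ≈⟨ summand-step-n₁>0 a j ⟩
      firstPartFactor m ⊛ summand a (suc j) ⊕ (correction m (2 +ℕ a) j ⊕ ⊖ correction m a (suc j))
    ≈⟨ ⊕-cong (⊛-congˡ (firstPartFactor m) (≡⇒≈ summandAt≡))
              (⊕-cong (≡⇒≈ correctionAt≡) (⊖-cong (≡⇒≈ correctionAt′≡))) ⟨
      firstPartFactor m ⊛ summandAt m (suc j) ⊕ (correctionAt m (suc j) ⊕ ⊖ correctionAt m (suc (suc j))) ∎
    where
    open ≈-Reasoning
    m : ℕ
    m = 2 +ℕ (2 *ℕ j +ℕ a)
    1+m≡2[1+j]+[1+a] : ∀ a j → suc (2 +ℕ (2 *ℕ j +ℕ a)) ≡ 2 *ℕ suc j +ℕ suc a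
    1+m≡2[1+j]+[1+a] = solve-∀
    m≡2[1+j]+a : ∀ a j → 2 +ℕ (2 *ℕ j +ℕ a) ≡ 2 *ℕ suc j +ℕ a
    m≡2[1+j]+a = solve-∀
    m≡2j+[2+a] : ∀ a j → 2 +ℕ (2 *ℕ j +ℕ a) ≡ 2 *ℕ j +ℕ (2 +ℕ a)
    m≡2j+[2+a] = solve-∀
    summandAt≡ : summandAt m (suc j) ≡ summand a (suc j)
    summandAt≡ = trans (cong (λ x → summandAt x (suc j)) (m≡2[1+j]+a a j)) (summandAt-+ (suc j) a)
    correctionAt≡ : correctionAt m (suc j) ≡ correction m (2 +ℕ a) j
    correctionAt≡ = subst (λ x → correctionAt x (suc j) ≡ correction x (2 +ℕ a) j) (sym (m≡2j+[2+a] a j))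
                          (correctionAt-+ j (2 +ℕ a))
    correctionAt′≡ : correctionAt m (suc (suc j)) ≡ correction m a (suc j)
    correctionAt′≡ = subst (λ x → correctionAt x (suc (suc j)) ≡ correction x a (suc j)) (sym (m≡2[1+j]+a a j))
                           (correctionAt-+ (suc j) a)

  summandAt-step-n₁≡0 : ∀ j → SummandAtStep (suc (2 *ℕ j)) (suc j)
  summandAt-step-n₁≡0 j = begin
      oneMinusQ (2 *ℕ suc m) ⊛ summandAt (suc m) (suc j)
    ≈⟨ ⊛-congˡ (oneMinusQ (2 *ℕ suc m)) (≡⇒≈ (trans (cong (λ x → summandAt x (suc j)) (2+2j≡2[1+j]+0 j)) (summandAt-+ (suc j) 0))) ⟩
      oneMinusQ (2 *ℕ suc m) ⊛ summand 0 (suc j)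
    ≈⟨ summand-step-n₁≡0 j ⟩
      correction m 1 j
    ≈⟨ (λ n → trans (sym (ℤ.+-identityʳ _)) (sym (ℤ.+-identityˡ _))) ⟩
      𝟘 ⊕ (correction m 1 j ⊕ ⊖ 𝟘)
    ≈⟨ ⊕-cong (≈-trans (⊛-congˡ (firstPartFactor m) (≡⇒≈ (summandAt-> m (suc j) m<2[1+j]))) (⊛-zeroʳ (firstPartFactor m)))
              (⊕-cong (≡⇒≈ correctionAt≡) (⊖-cong (≡⇒≈ (correctionAt-> m (suc j) m<2[1+j])))) ⟨
      firstPartFactor m ⊛ summandAt m (suc j) ⊕ (correctionAt m (suc j) ⊕ ⊖ correctionAt m (suc (suc j))) ∎
    where
    open ≈-Reasoning
    m : ℕ
    m = suc (2 *ℕ j)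
    2+2j≡2[1+j]+0 : ∀ j → suc (suc (2 *ℕ j)) ≡ 2 *ℕ suc j +ℕ 0
    2+2j≡2[1+j]+0 = solve-∀
    m<2[1+j] : m <ℕ 2 *ℕ suc j
    m<2[1+j] = subst (m <ℕ_) (trans (2+2j≡2[1+j]+0 j) (ℕ.+-identityʳ _)) ℕ.≤-refl
    correctionAt≡ : correctionAt m (suc j) ≡ correction m 1 j
    correctionAt≡ = subst (λ x → correctionAt x (suc j) ≡ correction x 1 j) (ℕ.+-comm (2 *ℕ j) 1)
                          (correctionAt-+ j 1)

  summandAt-step-empty : ∀ m j → m ≤ℕ 2 *ℕ j → SummandAtStep m (suc j)
  summandAt-step-empty m j m≤2j = begin
      oneMinusQ (2 *ℕ suc m) ⊛ summandAt (suc m) (suc j)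
    ≈⟨ ⊛-congˡ (oneMinusQ (2 *ℕ suc m)) (≡⇒≈ (summandAt-> (suc m) (suc j) 1+m<2[1+j])) ⟩
      oneMinusQ (2 *ℕ suc m) ⊛ 𝟘
    ≈⟨ ⊛-zeroʳ (oneMinusQ (2 *ℕ suc m)) ⟩
      𝟘 ⊕ (𝟘 ⊕ ⊖ 𝟘)
    ≈⟨ ⊕-cong (≈-trans (⊛-congˡ (firstPartFactor m) (≡⇒≈ (summandAt-> m (suc j) m<2[1+j]))) (⊛-zeroʳ (firstPartFactor m)))
              (⊕-cong (correctionAt-vanishes m j m≤2j) (⊖-cong (≡⇒≈ (correctionAt-> m (suc j) m<2[1+j])))) ⟨
      firstPartFactor m ⊛ summandAt m (suc j) ⊕ (correctionAt m (suc j) ⊕ ⊖ correctionAt m (suc (suc j))) ∎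
    where
    open ≈-Reasoning
    1+m<2[1+j] : suc m <ℕ 2 *ℕ suc j
    1+m<2[1+j] = subst (suc m <ℕ_) (sym (ℕ.*-suc 2 j)) (s≤s (s≤s m≤2j))
    m<2[1+j] : m <ℕ 2 *ℕ suc j
    m<2[1+j] = ℕ.<-trans (ℕ.n<1+n m) 1+m<2[1+j]

  summandAt-step : ∀ m k → SummandAtStep m k
  summandAt-step m zero    = summandAt-step-n₂≡0 m
  summandAt-step m (suc j) with ℕ.<-cmp m (suc (2 *ℕ j))
  ... | tri< m<1+2j _ _ = summandAt-step-empty m j (ℕ.≤-pred m<1+2j)
  ... | tri≈ _ refl _   = summandAt-step-n₁≡0 j
  ... | tri> _ _ 1+2j<m = subst (λ m → SummandAtStep m (suc j)) (ℕ.m+[n∸m]≡n 1+2j<m)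
                                (summandAt-step-n₁>0 (m ∸ suc (suc (2 *ℕ j))) j)

  doubleSumCoeff : ℕ → Series
  doubleSumCoeff m n = ∑ m (λ k → summandAt m k n)

  doubleSumCoeff-recurrence : ∀ m → oneMinusQ (2 *ℕ suc m) ⊛ doubleSumCoeff (suc m) ≈ firstPartFactor m ⊛ doubleSumCoeff m
  doubleSumCoeff-recurrence m n = begin
      (A ⊛ doubleSumCoeff (suc m)) n
    ≡⟨ ⊛-distrib-∑ A (suc m) (summandAt (suc m)) n ⟩
      ∑ (suc m) (λ k → (A ⊛ summandAt (suc m) k) n)
    ≡⟨ ∑-cong (suc m) (λ k → summandAt-step m k n) ⟩
      ∑ (suc m) (λ k → (V ⊛ summandAt m k) n + (correctionAt m k n - correctionAt m (suc k) n))
    ≡⟨ ∑-distrib-+ (suc m) (λ k → (V ⊛ summandAt m k) n) (λ k → correctionAt m k n - correctionAt m (suc k) n) ⟩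
      ∑ (suc m) (λ k → (V ⊛ summandAt m k) n) + ∑ (suc m) (λ k → correctionAt m k n - correctionAt m (suc k) n)
    ≡⟨ cong₂ _+_ (∑-suc m _) (∑-telescope (suc m) (λ k → correctionAt m k n)) ⟩
      ∑ m (λ k → (V ⊛ summandAt m k) n) + (V ⊛ summandAt m (suc m)) n + (+ 0 - correctionAt m (suc (suc m)) n)
    ≡⟨ cong₂ (λ x y → ∑ m (λ k → (V ⊛ summandAt m k) n) + x + (+ 0 - y))
             (trans (cong (λ s → (V ⊛ s) n) (summandAt-> m (suc m) m<2[1+m])) (⊛-zeroʳ V n))
             (cong (λ s → s n) (correctionAt-> m (suc m) m<2[1+m])) ⟩
      ∑ m (λ k → (V ⊛ summandAt m k) n) + + 0 + + 0
    ≡⟨ trans (ℤ.+-identityʳ _) (ℤ.+-identityʳ _) ⟩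
      ∑ m (λ k → (V ⊛ summandAt m k) n)
    ≡⟨ ⊛-distrib-∑ V m (summandAt m) n ⟨
      (V ⊛ doubleSumCoeff m) n ∎
    where
    open ≡-Reasoning
    A V : Series
    A = oneMinusQ (2 *ℕ suc m)
    V = firstPartFactor m
    m<2[1+m] : m <ℕ 2 *ℕ suc m
    m<2[1+m] = ℕ.<-≤-trans (ℕ.n<1+n m) (ℕ.m≤n*m (suc m) 2)

  doubleSumCoeff-zero : doubleSumCoeff 0 ≈ oneS
  doubleSumCoeff-zero = ≈-trans (⊛-identityˡ (inv D)) (≈-sym (≈-trans
    (inv-unique D oneS oneS (denominator-constant-term 0 0) (≈-trans (⊛-identityʳ D) (⊛-identityˡ oneS)))
    (⊛-identityʳ (inv D))))
    where
    D : Series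
    D = denominator 0 0

  pentagonal-double : ∀ n → 2 *ℕ pentagonal n +ℕ n ≡ 3 *ℕ n *ℕ n
  pentagonal-double zero    = refl
  pentagonal-double (suc n) = begin
      2 *ℕ (pentagonal n +ℕ (3 *ℕ n +ℕ 1)) +ℕ suc n
    ≡⟨ regroup n (pentagonal n) ⟩
      (2 *ℕ pentagonal n +ℕ n) +ℕ (6 *ℕ n +ℕ 3)
    ≡⟨ cong (_+ℕ (6 *ℕ n +ℕ 3)) (pentagonal-double n) ⟩
      3 *ℕ n *ℕ n +ℕ (6 *ℕ n +ℕ 3)
    ≡⟨ 3n²+6n+3≡3[1+n]² n ⟩
      3 *ℕ suc n *ℕ suc n ∎
    where
    open ≡-Reasoning
    regroup : ∀ n p → 2 *ℕ (p +ℕ (3 *ℕ n +ℕ 1)) +ℕ suc n ≡ (2 *ℕ p +ℕ n) +ℕ (6 *ℕ n +ℕ 3)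
    regroup = solve-∀
    3n²+6n+3≡3[1+n]² : ∀ n → 3 *ℕ n *ℕ n +ℕ (6 *ℕ n +ℕ 3) ≡ 3 *ℕ suc n *ℕ suc n
    3n²+6n+3≡3[1+n]² = solve-∀

  half-double : ∀ p → (2 *ℕ p) / 2 ≡ p
  half-double p = trans (cong (_/ 2) (ℕ.*-comm 2 p)) (m*n/n≡m p 2)

  pentagonal-formula : ∀ n → (3 *ℕ n *ℕ n ∸ n) / 2 ≡ pentagonal n
  pentagonal-formula n = begin
      (3 *ℕ n *ℕ n ∸ n) / 2
    ≡⟨ cong (λ x → (x ∸ n) / 2) (pentagonal-double n) ⟨
      (2 *ℕ pentagonal n +ℕ n ∸ n) / 2
    ≡⟨ cong (_/ 2) (ℕ.m+n∸n≡m (2 *ℕ pentagonal n) n) ⟩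
      (2 *ℕ pentagonal n) / 2
    ≡⟨ half-double (pentagonal n) ⟩
      pentagonal n ∎
    where open ≡-Reasoning

  pentagonal-formula′ : ∀ n → (3 *ℕ n *ℕ n +ℕ 3 *ℕ n) / 2 ≡ pentagonal n +ℕ 2 *ℕ n
  pentagonal-formula′ n = begin
      (3 *ℕ n *ℕ n +ℕ 3 *ℕ n) / 2
    ≡⟨ cong (λ x → (x +ℕ 3 *ℕ n) / 2) (pentagonal-double n) ⟨
      (2 *ℕ pentagonal n +ℕ n +ℕ 3 *ℕ n) / 2
    ≡⟨ cong (_/ 2) (regroup n (pentagonal n)) ⟩
      (2 *ℕ (pentagonal n +ℕ 2 *ℕ n)) / 2
    ≡⟨ half-double (pentagonal n +ℕ 2 *ℕ n) ⟩
      pentagonal n +ℕ 2 *ℕ n ∎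
    where
    open ≡-Reasoning
    regroup : ∀ n p → 2 *ℕ p +ℕ n +ℕ 3 *ℕ n ≡ 2 *ℕ (p +ℕ 2 *ℕ n)
    regroup = solve-∀

  ∑-select : ∀ m c (X : ℕ → ℤ) →
    ∑ m (λ n₁ → if m ≡ᵇ c +ℕ n₁ then X n₁ else + 0) ≡ (if c ≤ᵇ m then X (m ∸ c) else + 0)
  ∑-select m c X with c ℕ.≤? m
  ... | yes c≤m rewrite ≤ᵇ-true c≤m = begin
      ∑ m (λ n₁ → if m ≡ᵇ c +ℕ n₁ then X n₁ else + 0)
    ≡⟨ ∑-cong m (λ n₁ → trans (cong (λ b → if b then X n₁ else + 0) (≡ᵇ-+ c m n₁ c≤m)) (if-δ (n₁ ≡ᵇ m ∸ c) (X n₁))) ⟩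
      ∑ m (λ n₁ → δ n₁ (m ∸ c) * X n₁)
    ≡⟨ ∑-δ m (m ∸ c) X (ℕ.m∸n≤m m c) ⟩
      X (m ∸ c) ∎
    where
    open ≡-Reasoning
    if-δ : ∀ b x → (if b then x else + 0) ≡ (if b then + 1 else + 0) * x
    if-δ true  x = sym (ℤ.*-identityˡ x)
    if-δ false x = refl
  ... | no c≰m rewrite ≤ᵇ-false (ℕ.≰⇒> c≰m) = trans
    (∑-cong m (λ n₁ → cong (λ b → if b then X n₁ else + 0)
                           (≡ᵇ-≢ (ℕ.<⇒≢ (ℕ.<-≤-trans (ℕ.≰⇒> c≰m) (ℕ.m≤m+n c n₁))))))
    (∑-zero m)

  summandAt-apply : ∀ m k n → summandAt m k n ≡ (if 2 *ℕ k ≤ᵇ m then summand (m ∸ 2 *ℕ k) k n else + 0)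
  summandAt-apply m k n with 2 *ℕ k ≤ᵇ m
  ... | true  = refl
  ... | false = refl

  qpow-⊛-summandAt-apply : ∀ a m k n → (qpow a ⊛ summandAt m k) n ≡
    (if 2 *ℕ k ≤ᵇ m then (qpow a ⊛ summand (m ∸ 2 *ℕ k) k) n else + 0)
  qpow-⊛-summandAt-apply a m k n with 2 *ℕ k ≤ᵇ m
  ... | true  = refl
  ... | false = ⊛-zeroʳ (qpow a) n

  rhs22≡doubleSumCoeff : ∀ n m → rhs22 n m ≡ doubleSumCoeff m n
  rhs22≡doubleSumCoeff n m = begin
      rhs22 n m
    ≡⟨ trans (sumℤ-map-upTo m _) (∑-cong m (λ n₁ → sumℤ-map-upTo m _)) ⟩
      ∑ m (λ n₁ → ∑ m (λ n₂ → entry n₁ n₂))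
    ≡⟨ ∑-swap m m entry ⟩
      ∑ m (λ n₂ → ∑ m (λ n₁ → entry n₁ n₂))
    ≡⟨ ∑-cong m (λ n₂ → ∑-select m (2 *ℕ n₂) (λ n₁ → X n₁ n₂)) ⟩
      ∑ m (λ n₂ → if 2 *ℕ n₂ ≤ᵇ m then X (m ∸ 2 *ℕ n₂) n₂ else + 0)
    ≡⟨ ∑-cong m (λ n₂ → trans (cong (λ x → if 2 *ℕ n₂ ≤ᵇ m then x else + 0) (X≡summand (m ∸ 2 *ℕ n₂) n₂))
                              (sym (summandAt-apply m n₂ n))) ⟩
      doubleSumCoeff m n ∎
    where
    open ≡-Reasoning
    e : ℕ → ℕ → ℕ
    e n₁ n₂ = 4 *ℕ n₂ *ℕ n₂ +ℕ (3 *ℕ n₁ *ℕ n₁ ∸ n₁) / 2 +ℕ 4 *ℕ n₂ *ℕ n₁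
    X : ℕ → ℕ → ℤ
    X n₁ n₂ = (qpow (e n₁ n₂) ⊛ inv (denominator n₁ n₂)) n
    entry : ℕ → ℕ → ℤ
    entry n₁ n₂ = term (e n₁ n₂) (2 *ℕ n₂ +ℕ n₁) n₁ n₂ n m
    X≡summand : ∀ n₁ n₂ → X n₁ n₂ ≡ summand n₁ n₂ n
    X≡summand n₁ n₂ = cong (λ p → (qpow (4 *ℕ n₂ *ℕ n₂ +ℕ p +ℕ 4 *ℕ n₂ *ℕ n₁) ⊛ inv (denominator n₁ n₂)) n)
                           (pentagonal-formula n₁)

  rhs21≡qpow-⊛-doubleSumCoeff : ∀ n m → rhs21 n m ≡ (qpow (2 *ℕ m) ⊛ doubleSumCoeff m) n
  rhs21≡qpow-⊛-doubleSumCoeff n m = begin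
      rhs21 n m
    ≡⟨ trans (sumℤ-map-upTo m _) (∑-cong m (λ n₁ → sumℤ-map-upTo m _)) ⟩
      ∑ m (λ n₁ → ∑ m (λ n₂ → entry n₁ n₂))
    ≡⟨ ∑-swap m m entry ⟩
      ∑ m (λ n₂ → ∑ m (λ n₁ → entry n₁ n₂))
    ≡⟨ ∑-cong m (λ n₂ → ∑-select m (2 *ℕ n₂) (λ n₁ → X n₁ n₂)) ⟩
      ∑ m (λ n₂ → if 2 *ℕ n₂ ≤ᵇ m then X (m ∸ 2 *ℕ n₂) n₂ else + 0)
    ≡⟨ ∑-cong m (λ n₂ → trans (if-cong (2 *ℕ n₂ ≤ᵇ m) (λ 2n₂≤m → X≡shifted-summand n₂ (≤ᵇ-sound 2n₂≤m)))
                              (sym (qpow-⊛-summandAt-apply (2 *ℕ m) m n₂ n))) ⟩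
      ∑ m (λ n₂ → (qpow (2 *ℕ m) ⊛ summandAt m n₂) n)
    ≡⟨ ⊛-distrib-∑ (qpow (2 *ℕ m)) m (summandAt m) n ⟨
      (qpow (2 *ℕ m) ⊛ doubleSumCoeff m) n ∎
    where
    open ≡-Reasoning
    e : ℕ → ℕ → ℕ
    e n₁ n₂ = 4 *ℕ n₂ *ℕ n₂ +ℕ 4 *ℕ n₂ +ℕ (3 *ℕ n₁ *ℕ n₁ +ℕ 3 *ℕ n₁) / 2 +ℕ 4 *ℕ n₂ *ℕ n₁
    X : ℕ → ℕ → ℤ
    X n₁ n₂ = (qpow (e n₁ n₂) ⊛ inv (denominator n₁ n₂)) n
    entry : ℕ → ℕ → ℤ
    entry n₁ n₂ = term (e n₁ n₂) (2 *ℕ n₂ +ℕ n₁) n₁ n₂ n m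
    regroup : ∀ n₁ n₂ p → 4 *ℕ n₂ *ℕ n₂ +ℕ 4 *ℕ n₂ +ℕ (p +ℕ 2 *ℕ n₁) +ℕ 4 *ℕ n₂ *ℕ n₁
                     ≡ 2 *ℕ (2 *ℕ n₂ +ℕ n₁) +ℕ (4 *ℕ n₂ *ℕ n₂ +ℕ p +ℕ 4 *ℕ n₂ *ℕ n₁)
    regroup = solve-∀
    e≡2[2n₂+n₁]+exponent : ∀ n₁ n₂ → e n₁ n₂ ≡ 2 *ℕ (2 *ℕ n₂ +ℕ n₁) +ℕ exponent n₁ n₂
    e≡2[2n₂+n₁]+exponent n₁ n₂ = trans (cong (λ p → 4 *ℕ n₂ *ℕ n₂ +ℕ 4 *ℕ n₂ +ℕ p +ℕ 4 *ℕ n₂ *ℕ n₁) (pentagonal-formula′ n₁))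
                     (regroup n₁ n₂ (pentagonal n₁))
    X≡shifted-summand : ∀ n₂ → 2 *ℕ n₂ ≤ℕ m → X (m ∸ 2 *ℕ n₂) n₂ ≡ (qpow (2 *ℕ m) ⊛ summand (m ∸ 2 *ℕ n₂) n₂) n
    X≡shifted-summand n₂ 2n₂≤m = begin
        (qpow (e n₁ n₂) ⊛ inv (denominator n₁ n₂)) n
      ≡⟨ cong (λ x → (qpow x ⊛ inv (denominator n₁ n₂)) n)
              (trans (e≡2[2n₂+n₁]+exponent n₁ n₂) (cong (λ x → 2 *ℕ x +ℕ exponent n₁ n₂) (ℕ.m+[n∸m]≡n 2n₂≤m))) ⟩
        (qpow (2 *ℕ m +ℕ exponent n₁ n₂) ⊛ inv (denominator n₁ n₂)) n
      ≡⟨ ⊛-congʳ (inv (denominator n₁ n₂)) (qpow-+ (2 *ℕ m) (exponent n₁ n₂)) n ⟨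
        ((qpow (2 *ℕ m) ⊛ qpow (exponent n₁ n₂)) ⊛ inv (denominator n₁ n₂)) n
      ≡⟨ ⊛-assoc (qpow (2 *ℕ m)) (qpow (exponent n₁ n₂)) (inv (denominator n₁ n₂)) n ⟩
        (qpow (2 *ℕ m) ⊛ summand n₁ n₂) n ∎
      where
      n₁ : ℕ
      n₁ = m ∸ 2 *ℕ n₂


open BooleanComparisons
open GapPartitions
open PowerSeries
open DoubleSum
open import Data.Nat using (zero; suc; z≤n; s≤s) renaming (_+_ to _+ℕ_; _*_ to _*ℕ_)
import Data.Nat.Properties as ℕ
open import Data.Integer using (_+_)
import Data.Integer.Properties as ℤ
open import Data.Product using (_,_)
open import Relation.Nullary using (yes; no)
open import Relation.Binary.PropositionalEquality using (refl; trans; sym; cong; cong₂; module ≡-Reasoning)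

delay-qpow : ∀ a g n → + delay a g n ≡ (qpow a ⊛ (λ z → + g z)) n
delay-qpow a g n with a ℕ.≤? n
... | yes a≤n rewrite ≤ᵇ-true a≤n = sym (qpow-⊛ a (λ z → + g z) n a≤n)
... | no  a≰n rewrite ≤ᵇ-false (ℕ.≰⇒> a≰n) = sym (qpow-⊛-< a (λ z → + g z) n (ℕ.≰⇒> a≰n))

gapSeries : ℕ → Series
gapSeries m n = + gapCount 1 n m

gapSeries-zero : gapSeries 0 ≈ oneS
gapSeries-zero zero    = refl
gapSeries-zero (suc n) = refl

gapSeries-unfold : ∀ m → gapSeries (suc m) ≈ firstPartFactor m ⊛ gapSeries m ⊕ qpow (2 *ℕ suc m) ⊛ gapSeries (suc m)
gapSeries-unfold m n = begin
    + gapCount 1 n (suc m)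
  ≡⟨ cong +_ (gapCount-recurrence n m) ⟩
    + (delay a g n +ℕ (delay b g n +ℕ delay c g′ n))
  ≡⟨ trans (ℤ.pos-+ (delay a g n) _) (cong (_+_ (+ delay a g n)) (ℤ.pos-+ (delay b g n) _)) ⟩
    + delay a g n + (+ delay b g n + + delay c g′ n)
  ≡⟨ cong₂ _+_ (delay-qpow a g n) (cong₂ _+_ (delay-qpow b g n) (delay-qpow c g′ n)) ⟩
    (qpow a ⊛ gapSeries m) n + ((qpow b ⊛ gapSeries m) n + (qpow c ⊛ gapSeries (suc m)) n)
  ≡⟨ ℤ.+-assoc ((qpow a ⊛ gapSeries m) n) _ _ ⟨
    (qpow a ⊛ gapSeries m) n + (qpow b ⊛ gapSeries m) n + (qpow c ⊛ gapSeries (suc m)) n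
  ≡⟨ cong (_+ (qpow c ⊛ gapSeries (suc m)) n) (⊛-distribʳ (gapSeries m) (qpow a) (qpow b) n) ⟨
    (firstPartFactor m ⊛ gapSeries m ⊕ qpow c ⊛ gapSeries (suc m)) n ∎
  where
  open ≡-Reasoning
  a b c : ℕ
  a = 1 +ℕ 2 *ℕ m
  b = 2 +ℕ (2 *ℕ m +ℕ 2 *ℕ m)
  c = 2 *ℕ suc m
  g g′ : ℕ → ℕ
  g z = gapCount 1 z m
  g′ z = gapCount 1 z (suc m)

gapSeries-recurrence : ∀ m → oneMinusQ (2 *ℕ suc m) ⊛ gapSeries (suc m) ≈ firstPartFactor m ⊛ gapSeries m
gapSeries-recurrence m = begin
    oneMinusQ (2 *ℕ suc m) ⊛ gapSeries (suc m)
  ≈⟨ expand (qpow (2 *ℕ suc m)) (gapSeries (suc m)) ⟩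
    gapSeries (suc m) ⊕ ⊖ (qpow (2 *ℕ suc m) ⊛ gapSeries (suc m))
  ≈⟨ ⊕-cong (gapSeries-unfold m) ≈-refl ⟩
    firstPartFactor m ⊛ gapSeries m ⊕ qpow (2 *ℕ suc m) ⊛ gapSeries (suc m) ⊕ ⊖ (qpow (2 *ℕ suc m) ⊛ gapSeries (suc m))
  ≈⟨ cancel (firstPartFactor m ⊛ gapSeries m) (qpow (2 *ℕ suc m) ⊛ gapSeries (suc m)) ⟩
    firstPartFactor m ⊛ gapSeries m ∎
  where
  open ≈-Reasoning
  open SeriesSolver using (solve; _:+_; _:-_; _:*_; _:=_; con)
  expand : ∀ Q F → (oneS ⊕ ⊖ Q) ⊛ F ≈ F ⊕ ⊖ (Q ⊛ F)
  expand = solve 2 (λ Q F → (con (+ 1) :- Q) :* F := F :- Q :* F) (λ _ → refl)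
  cancel : ∀ X Y → X ⊕ Y ⊕ ⊖ Y ≈ X
  cancel = solve 2 (λ X Y → X :+ Y :- Y := X) (λ _ → refl)

gapSeries≈doubleSumCoeff : ∀ m → gapSeries m ≈ doubleSumCoeff m
gapSeries≈doubleSumCoeff = recurrence-unique (λ m → oneMinusQ (2 *ℕ suc m)) firstPartFactor gapSeries doubleSumCoeff
  (λ m → refl) gapSeries-recurrence doubleSumCoeff-recurrence (≈-trans gapSeries-zero (≈-sym doubleSumCoeff-zero))

theorem13 : ((n m : ℕ) → + D22 n m ≡ rhs22 n m) × ((n m : ℕ) → + D21 n m ≡ rhs21 n m)
theorem13 = (λ n m → begin
      + D22 n m           ≡⟨ cong +_ (D22≡gapCount n m) ⟩
      gapSeries m n       ≡⟨ gapSeries≈doubleSumCoeff m n ⟩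
      doubleSumCoeff m n  ≡⟨ rhs22≡doubleSumCoeff n m ⟨
      rhs22 n m           ∎)
  , (λ n m → begin
      + D21 n m
        ≡⟨ cong +_ (trans (D21≡gapCount n m) (gapCount-shift-delay m 1 n (s≤s z≤n))) ⟩
      + delay (2 *ℕ m) (λ z → gapCount 1 z m) n
        ≡⟨ delay-qpow (2 *ℕ m) (λ z → gapCount 1 z m) n ⟩
      (qpow (2 *ℕ m) ⊛ gapSeries m) n
        ≡⟨ ⊛-congˡ (qpow (2 *ℕ m)) (gapSeries≈doubleSumCoeff m) n ⟩
      (qpow (2 *ℕ m) ⊛ doubleSumCoeff m) n
        ≡⟨ rhs21≡qpow-⊛-doubleSumCoeff n m ⟨
      rhs21 n m ∎)
  where open ≡-Reasoning
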